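{- Let $D$ be a nonempty finite set of pixels of the regular orthogonal grid in $\mathbb{R}^2$ (a digital object). Let $p$ be the number of pixels of $D$, $v$ the number of distinct grid points that are a vertex of at least one pixel of $D$, $h$ the number of holes of $D$, $c$ the number of connected components of $D$, $b$ the number of 2-blocks of $D$, and $t$ the number of $0$-tunnels of $D$ (all as defined in the context). Then $$t = v - 2(p + c - h) + b.$$
   Context: Pixels are the closed unit squares of $\mathbb{R}^2$ centered at the points of $\mathbb{Z}^2$; a pixel has four vertices (grid points with half-integer coordinates). Two pixels are $0$-adjacent if they share a vertex and $1$-adjacent if they share an edge. A $k$-path ($k\in\{0,1\}$) is a sequence of pixels in which consecutive pixels are $k$-adjacent; the $k$-components of a set of pixels are its maximal $k$-connected subsets. The connected components of $D$ counted by $c$ are its $0$-components. The holes of $D$ counted by $h$ are the finite $1$-components of the complement $\mathbb{Z}^2\setminus D$ (the set of all pixels not in $D$); the unique infinite $1$-component is not counted. A 2-block of $D$ is a $2\times 2$ square of four pixels all belonging to $D$. A $0$-tunnel of $D$ is a grid point $x$ such that among the four pixels having $x$ as a vertex exactly two belong to $D$ and these two are diagonally opposite (i.e., $0$-adjacent but not $1$-adjacent); $t$ counts such points. -}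

module Defs where

open import Data.Nat as ℕ using (ℕ)
open import Data.Integer as ℤ using (ℤ; ∣_∣; _-_; _+_; +_)
open import Data.Product using (Σ; _×_; _,_)
open import Data.Sum using (_⊎_)
open import Data.List using (List; length)
open import Data.List.Membership.Propositional using (_∈_; _∉_)
open import Data.List.Relation.Unary.All using (All)
open import Data.List.Relation.Unary.Any using (Any)
open import Data.List.Relation.Unary.Unique.Propositional using (Unique)
open import Data.List.Relation.Unary.AllPairs using (AllPairs)
open import Relation.Binary.PropositionalEquality using (_≡_)
open import Relation.Binary.Construct.Closure.ReflexiveTransitive using (Star)
open import Relation.Nullary using (¬_)

-- A pixel is identified with its centre (a , b) ∈ ℤ².
Pixel : Set
Pixel = ℤ × ℤ

-- A grid point (half-integer coordinates) (i+½ , j+½) is encoded by (i , j) ∈ ℤ².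
GridPoint : Set
GridPoint = ℤ × ℤ

-- A digital object: a finite list of pixels (duplicates excluded in the theorem).
Obj : Set
Obj = List Pixel

Adj1 : Pixel → Pixel → Set
Adj1 (a , b) (a' , b') = ∣ a - a' ∣ ℕ.+ ∣ b - b' ∣ ≡ 1

-- 0-adjacent: share a vertex (reflexive pairs included; harmless for paths).
Adj0 : Pixel → Pixel → Set
Adj0 (a , b) (a' , b') = (∣ a - a' ∣ ℕ.≤ 1) × (∣ b - b' ∣ ℕ.≤ 1)

Restrict : (Pixel → Set) → (Pixel → Pixel → Set) → Pixel → Pixel → Set
Restrict S adj x y = S x × S y × adj x y

Conn : (Pixel → Set) → (Pixel → Pixel → Set) → Pixel → Pixel → Set
Conn S adj = Star (Restrict S adj)

Compl : Obj → Pixel → Set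
Compl D x = x ∉ D

HasVertex : Pixel → GridPoint → Set
HasVertex (a , b) (i , j) = ((a ≡ i) ⊎ (a ≡ i + + 1)) × ((b ≡ j) ⊎ (b ≡ j + + 1))

IsVertex : Obj → GridPoint → Set
IsVertex D g = Σ Pixel λ x → x ∈ D × HasVertex x g

-- 2-block identified with its central grid point (i , j):
-- the four pixels (i,j), (i+1,j), (i,j+1), (i+1,j+1) all lie in D.
Block : Obj → GridPoint → Set
Block D (i , j) =
  ((i , j) ∈ D) × ((i + + 1 , j) ∈ D) × ((i , j + + 1) ∈ D) × ((i + + 1 , j + + 1) ∈ D)

Tunnel : Obj → GridPoint → Set
Tunnel D (i , j) =
  (((i , j) ∈ D) × ((i + + 1 , j + + 1) ∈ D) × ((i + + 1 , j) ∉ D) × ((i , j + + 1) ∉ D))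
  ⊎ (((i + + 1 , j) ∈ D) × ((i , j + + 1) ∈ D) × ((i , j) ∉ D) × ((i + + 1 , j + + 1) ∉ D))

HasSize : (ℤ × ℤ → Set) → ℕ → Set
HasSize P n = Σ (List (ℤ × ℤ)) λ L →
  Unique L × length L ≡ n × (∀ x → x ∈ L → P x) × (∀ x → P x → x ∈ L)

NumClasses : (ℤ × ℤ → Set) → (ℤ × ℤ → ℤ × ℤ → Set) → ℕ → Set
NumClasses S R n = Σ (List (ℤ × ℤ)) λ L →
  length L ≡ n × All S L × AllPairs (λ x y → ¬ R x y) L × (∀ x → S x → Any (R x) L)

Comp0 : Obj → Pixel → Pixel → Set
Comp0 D = Conn (λ x → x ∈ D) Adj0

CompCompl1 : Obj → Pixel → Pixel → Set
CompCompl1 D = Conn (Compl D) Adj1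

InHole : Obj → Pixel → Set
InHole D x = Compl D x × Σ (List Pixel) λ L → ∀ y → CompCompl1 D x y → y ∈ L

-- For a grid point g let ψ(g) = [some pixel at g lies in D] + [all four do] − [g is a 0-tunnel].
-- Summed over all grid points this is v + b − t, so the claim says Σ ψ = 2 (p + c − h).
-- This is proved by induction on D, removing the pixel x that is last in row-major order:
-- then ψ changes only at the four corners of x, and among the pixels of D only L, LL, B, BR
-- (left, lower left, below, lower right of x) can touch x, so both the change of Σ ψ and the
-- change of c and h are determined by which of these four lie in D. The one delicate case is
-- B ∉ D, BR ∈ D with L or LL in D: adding x either joins two components or closes B off as
-- a new hole. A discrete Jordan argument decides which: a grid walk from a corner of L/LL to
-- a corner of BR through D, closed by the edge between x and B, separates B from the pixel
-- above x (ray-crossing parity); conversely, if B lies in a finite hole, the boundary of that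
-- hole links those two corners (handshake lemma on the boundary graph).
module Submission where

open import Defs

open import Algebra.Solver.Ring.AlmostCommutativeRing using (fromCommutativeRing)
open import Data.Bool using (Bool; true; false; _∧_; _∨_; not; _xor_; if_then_else_; T)
open import Data.Bool.Properties
  using (xor-assoc; xor-same; xor-identityʳ; ∧-zeroʳ; ∧-identityʳ; ∧-distribˡ-xor; xor-∧-commutativeRing)
  renaming (_≟_ to _≟ᵇ_)
open import Data.Empty using (⊥-elim)
open import Data.Integer as ℤ using (ℤ; 1ℤ; +_; -[1+_]; _+_; _-_; _*_; -_; ∣_∣; _≤_; _<_)
import Data.Integer.Properties as ZP
open import Data.Integer.Solver using () renaming (module +-*-Solver to ZS)
open import Data.List using (List; length; []; _∷_; _++_; filter; map; upTo; cartesianProduct)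
import Data.List.Properties as LP
open import Data.List.Membership.Propositional using (_∈_; _∉_)
open import Data.List.Membership.Propositional.Properties
  using (∈-map⁺; ∈-upTo⁺; ∈-cartesianProduct⁺; ∈-filter⁺; ∈-filter⁻; ∈-++⁺ʳ)
open import Data.List.Relation.Unary.All using (All; []; _∷_)
import Data.List.Relation.Unary.All as All
open import Data.List.Relation.Unary.AllPairs using (AllPairs; []; _∷_)
open import Data.List.Relation.Unary.Any using (Any; here; there)
import Data.List.Relation.Unary.Any as Any
open import Data.List.Relation.Unary.Unique.Propositional using (Unique)
import Data.List.Relation.Unary.Unique.Propositional.Properties as UP
open import Data.Nat as ℕ using (ℕ; zero; suc; z≤n; s≤s)
import Data.Nat.Properties as NP
open import Data.Product using (Σ; _×_; _,_; proj₁; proj₂)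
open import Data.Product.Properties using (≡-dec)
open import Data.Sum using (_⊎_; inj₁; inj₂)
import Data.Sum as Sum
open import Effect.Monad using (RawMonad)
open import Level using (0ℓ)
open import Relation.Binary.Construct.Closure.ReflexiveTransitive using (Star; ε; _◅_; _◅◅_; reverse)
open import Relation.Binary.PropositionalEquality
open import Relation.Nullary using (¬_; Dec; yes; no)
open import Relation.Nullary.Decidable using (⌊_⌋; ¬¬-excluded-middle; decidable-stable)
open import Relation.Nullary.Negation using (¬¬-Monad)

open import Algebra.Solver.Ring.Simple (fromCommutativeRing xor-∧-commutativeRing) _≟ᵇ_
  using (solve; _:=_; con) renaming (_:+_ to _⊕_)

-- Connectivity is not decidable constructively here, so the argument runs in the double
-- negation monad; the theorem is an equation of integers, hence ¬¬-stable.
open RawMonad (¬¬-Monad {a = 0ℓ}) using (pure; _>>=_)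

¬¬-decidableOn : {X : Set} (P : X → Set) (L : List X) → ¬ ¬ (∀ y → y ∈ L → Dec (P y))
¬¬-decidableOn P [] = pure (λ y ())
¬¬-decidableOn P (z ∷ L) = ¬¬-excluded-middle >>= λ d → ¬¬-decidableOn P L >>= λ f → pure (extend d f)
  where
  extend : Dec (P z) → (∀ y → y ∈ L → Dec (P y)) → ∀ y → y ∈ z ∷ L → Dec (P y)
  extend d f y (here refl) = d
  extend d f y (there m) = f y m

i+1-1≡i : ∀ i → (i + 1ℤ) - 1ℤ ≡ i
i+1-1≡i = ZS.solve 1 (λ i → (i ZS.:+ ZS.con 1ℤ) ZS.:- ZS.con 1ℤ ZS.:= i) refl

i-1+1≡i : ∀ i → (i - 1ℤ) + 1ℤ ≡ i
i-1+1≡i = ZS.solve 1 (λ i → (i ZS.:- ZS.con 1ℤ) ZS.:+ ZS.con 1ℤ ZS.:= i) refl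

i-j+j≡i : ∀ i j → i - j + j ≡ i
i-j+j≡i = ZS.solve 2 (λ i j → i ZS.:- j ZS.:+ j ZS.:= i) refl

[i+j]-[i+k]≡j-k : ∀ a d e → (a + d) - (a + e) ≡ d - e
[i+j]-[i+k]≡j-k = ZS.solve 3 (λ a d e → (a ZS.:+ d) ZS.:- (a ZS.:+ e) ZS.:= d ZS.:- e) refl

i-[i+j]≡-j : ∀ a e → a - (a + e) ≡ - e
i-[i+j]≡-j = ZS.solve 2 (λ a e → a ZS.:- (a ZS.:+ e) ZS.:= ZS.:- e) refl

[i+j]-i≡j : ∀ a d → (a + d) - a ≡ d
[i+j]-i≡j = ZS.solve 2 (λ a d → (a ZS.:+ d) ZS.:- a ZS.:= d) refl

<⇒+1≤ : ∀ {a i} → a < i → a + 1ℤ ≤ i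
<⇒+1≤ {a} {i} a<i = subst (_≤ i) (ZP.+-comm 1ℤ a) (ZP.i<j⇒suc[i]≤j a<i)

+1≤⇒< : ∀ {a i} → a + 1ℤ ≤ i → a < i
+1≤⇒< {a} {i} le = ZP.suc[i]≤j⇒i<j (subst (_≤ i) (ZP.+-comm a 1ℤ) le)

<⇒≤-1 : ∀ {a i} → a < i → a ≤ i - 1ℤ
<⇒≤-1 {a} {i} a<i = subst (a ≤_) (ZP.+-comm -[1+ 0 ] i) (ZP.i<j⇒i≤pred[j] a<i)

≤-1⇒< : ∀ {a i} → a ≤ i - 1ℤ → a < i
≤-1⇒< {a} {i} le = ZP.i≤pred[j]⇒i<j (subst (a ≤_) (ZP.+-comm i -[1+ 0 ]) le)

i-1<i : ∀ a → a - 1ℤ < a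
i-1<i a = ≤-1⇒< ZP.≤-refl

i<i+1 : ∀ a → a < a + 1ℤ
i<i+1 a = +1≤⇒< ZP.≤-refl

i-1≢i : ∀ a → ¬ a - 1ℤ ≡ a
i-1≢i a e = ZP.<-irrefl e (i-1<i a)

i+1≢i : ∀ a → ¬ a + 1ℤ ≡ a
i+1≢i a e = ZP.<-irrefl (sym e) (i<i+1 a)

i-1≢i+1 : ∀ a → ¬ a - 1ℤ ≡ a + 1ℤ
i-1≢i+1 a e = ZP.<-irrefl e (ZP.<-trans (i-1<i a) (i<i+1 a))

b≤ : ℤ → ℤ → Bool
b≤ a i = ⌊ a ZP.≤? i ⌋

b≡ : ℤ → ℤ → Bool
b≡ a i = ⌊ a ZP.≟ i ⌋

b≤-pred-xor : ∀ a i → (b≤ a (i - 1ℤ) xor b≤ a i) ≡ b≡ i a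
b≤-pred-xor a i with i ZP.≟ a
b≤-pred-xor a i | yes refl with a ZP.≤? (a - 1ℤ) | a ZP.≤? a
... | yes p | _ = ⊥-elim (ZP.<-irrefl refl (≤-1⇒< p))
... | no _ | yes _ = refl
... | no _ | no q = ⊥-elim (q ZP.≤-refl)
b≤-pred-xor a i | no i≢a with a ZP.≤? (i - 1ℤ) | a ZP.≤? i
... | yes _ | yes _ = refl
... | no _ | no _ = refl
... | yes p | no q = ⊥-elim (q (ZP.<⇒≤ (≤-1⇒< p)))
... | no p | yes q = ⊥-elim (p (<⇒≤-1 (ZP.≤∧≢⇒< q (λ e → i≢a (sym e)))))

b≤-suc-xor : ∀ a i → (b≤ a i xor b≤ (a + 1ℤ) i) ≡ b≡ i a
b≤-suc-xor a i with i ZP.≟ a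
b≤-suc-xor a i | yes refl with a ZP.≤? a | (a + 1ℤ) ZP.≤? a
... | _ | yes p = ⊥-elim (ZP.<-irrefl refl (+1≤⇒< p))
... | yes _ | no _ = refl
... | no q | no _ = ⊥-elim (q ZP.≤-refl)
b≤-suc-xor a i | no i≢a with a ZP.≤? i | (a + 1ℤ) ZP.≤? i
... | yes _ | yes _ = refl
... | no _ | no _ = refl
... | no q | yes p = ⊥-elim (q (ZP.<⇒≤ (+1≤⇒< p)))
... | yes q | no p = ⊥-elim (p (<⇒+1≤ (ZP.≤∧≢⇒< q (λ e → i≢a (sym e)))))

b≡-+1ʳ : ∀ j b → b≡ j (b + 1ℤ) ≡ b≡ (j - 1ℤ) b
b≡-+1ʳ j b with j ZP.≟ (b + 1ℤ) | (j - 1ℤ) ZP.≟ b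
... | yes _ | yes _ = refl
... | no _ | no _ = refl
... | yes refl | no q = ⊥-elim (q (i+1-1≡i b))
... | no q | yes refl = ⊥-elim (q (sym (i-1+1≡i j)))

∣i∣≤1-cases : ∀ d → ∣ d ∣ ℕ.≤ 1 → (d ≡ -[1+ 0 ]) ⊎ (d ≡ + 0) ⊎ (d ≡ + 1)
∣i∣≤1-cases (+ zero) _ = inj₂ (inj₁ refl)
∣i∣≤1-cases (+ suc zero) _ = inj₂ (inj₂ refl)
∣i∣≤1-cases (+ suc (suc n)) (s≤s ())
∣i∣≤1-cases -[1+ zero ] _ = inj₁ refl
∣i∣≤1-cases -[1+ suc n ] (s≤s ())

∣i∣≡1-cases : ∀ d → ∣ d ∣ ≡ 1 → (d ≡ -[1+ 0 ]) ⊎ (d ≡ + 1)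
∣i∣≡1-cases (+ suc zero) _ = inj₂ refl
∣i∣≡1-cases -[1+ zero ] _ = inj₁ refl

∣i∣+∣j∣≡1-cases : ∀ d e → ∣ d ∣ ℕ.+ ∣ e ∣ ≡ 1 →
  (((d ≡ -[1+ 0 ]) ⊎ (d ≡ + 1)) × e ≡ + 0) ⊎ (d ≡ + 0 × ((e ≡ -[1+ 0 ]) ⊎ (e ≡ + 1)))
∣i∣+∣j∣≡1-cases (+ zero) e p = inj₂ (refl , ∣i∣≡1-cases e p)
∣i∣+∣j∣≡1-cases (+ suc zero) e p = inj₁ (inj₂ refl , ZP.∣i∣≡0⇒i≡0 (NP.suc-injective p))
∣i∣+∣j∣≡1-cases -[1+ zero ] e p = inj₁ (inj₁ refl , ZP.∣i∣≡0⇒i≡0 (NP.suc-injective p))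
∣i∣+∣j∣≡1-cases (+ suc (suc n)) e ()
∣i∣+∣j∣≡1-cases -[1+ suc n ] e ()

i-j≡k⇒i≡j+k : ∀ y a d → y - a ≡ d → y ≡ a + d
i-j≡k⇒i≡j+k y a d p = trans (sym (i-j+j≡i y a)) (trans (cong (_+ a) p) (ZP.+-comm d a))

b≡⇒≡ : ∀ {i j} → b≡ i j ≡ true → i ≡ j
b≡⇒≡ {i} {j} p with i ZP.≟ j
... | yes q = q
b≡⇒≡ {i} {j} () | no _

b≡-refl : ∀ i → b≡ i i ≡ true
b≡-refl i with i ZP.≟ i
... | yes _ = refl
... | no q = ⊥-elim (q refl)

≢⇒b≡-false : ∀ {i j} → ¬ i ≡ j → b≡ i j ≡ false
≢⇒b≡-false {i} {j} ne with i ZP.≟ j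
... | yes q = ⊥-elim (ne q)
... | no _ = refl

∧≡true⇒ : ∀ {p q} → p ∧ q ≡ true → p ≡ true × q ≡ true
∧≡true⇒ {true} {true} _ = refl , refl

nb≡-refl : ∀ n → ⌊ n ℕ.≟ n ⌋ ≡ true
nb≡-refl n with n ℕ.≟ n
... | yes _ = refl
... | no q = ⊥-elim (q refl)

nb≢ : ∀ k n → ¬ k ≡ n → ⌊ k ℕ.≟ n ⌋ ≡ false
nb≢ k n ne with k ℕ.≟ n
... | yes q = ⊥-elim (ne q)
... | no _ = refl

b≡-+1ˡ : ∀ i c → b≡ (i + 1ℤ) c ≡ b≡ i (c - 1ℤ)
b≡-+1ˡ i c with (i + 1ℤ) ZP.≟ c | i ZP.≟ (c - 1ℤ)
... | yes _ | yes _ = refl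
... | no _ | no _ = refl
... | yes refl | no q = ⊥-elim (q (sym (i+1-1≡i i)))
... | no q | yes refl = ⊥-elim (q (i-1+1≡i c))

b≤⇒≤ : ∀ {a i} → b≤ a i ≡ true → a ≤ i
b≤⇒≤ {a} {i} p with a ZP.≤? i
... | yes q = q

≰⇒b≤-false : ∀ {a i} → ¬ a ≤ i → b≤ a i ≡ false
≰⇒b≤-false {a} {i} p with a ZP.≤? i
... | yes q = ⊥-elim (p q)
... | no _ = refl

≤⇒b≤ : ∀ {a i} → a ≤ i → b≤ a i ≡ true
≤⇒b≤ {a} {i} p with a ZP.≤? i
... | yes q = refl
... | no q = ⊥-elim (q p)

true∧true : ∀ {p q} → p ≡ true → q ≡ true → p ∧ q ≡ true
true∧true refl refl = refl

module _ {A : Set} where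

  Any-split : ∀ {P : A → Set} {xs} → Any P xs → Σ (List A) λ pre → Σ A λ z → Σ (List A) λ post → xs ≡ pre ++ z ∷ post × P z
  Any-split {xs = x ∷ xs} (here p) = [] , x , xs , refl , p
  Any-split {xs = x ∷ xs} (there a) with Any-split a
  ... | pre , z , post , refl , p = x ∷ pre , z , post , refl , p

  Any-remove : ∀ {P : A → Set} pre z post → Any P (pre ++ z ∷ post) → ¬ P z → Any P (pre ++ post)
  Any-remove [] z post (here p) np = ⊥-elim (np p)
  Any-remove [] z post (there a) np = a
  Any-remove (x ∷ pre) z post (here p) np = here p
  Any-remove (x ∷ pre) z post (there a) np = there (Any-remove pre z post a np)

  Any-middle : ∀ {P : A → Set} pre z post → Any P (pre ++ z ∷ post) → Any P (pre ++ post) ⊎ P z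
  Any-middle [] z post (here p) = inj₂ p
  Any-middle [] z post (there a) = inj₁ a
  Any-middle (x ∷ pre) z post (here p) = inj₁ (here p)
  Any-middle (x ∷ pre) z post (there a) with Any-middle pre z post a
  ... | inj₁ b = inj₁ (there b)
  ... | inj₂ p = inj₂ p

  length-≤-by-classes : ∀ (R T : A → A → Set) (L1 L2 : List A) →
    AllPairs (λ u v → ¬ R u v) L1 → (∀ u → u ∈ L1 → Any (T u) L2) →
    (∀ u v z → T u z → T v z → R u v) → length L1 ℕ.≤ length L2
  length-≤-by-classes R T [] L2 ap cov tr = z≤n
  length-≤-by-classes R T (u ∷ L1) L2 (hd ∷ ap) cov tr with Any-split (cov u (here refl))
  ... | pre , z , post , refl , tuz =
    subst (suc (length L1) ℕ.≤_) (sym (LP.length-++-sucʳ pre z post))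
        (s≤s (length-≤-by-classes R T L1 (pre ++ post) ap cov' tr))
    where
    cov' : ∀ v → v ∈ L1 → Any (T v) (pre ++ post)
    cov' v m = Any-remove pre z post (cov v (there m)) (λ tvz → All.lookup hd m (tr u v z tuz tvz))

  Unique-length-≤ : ∀ (L1 L2 : List A) → Unique L1 → (∀ z → z ∈ L1 → z ∈ L2) → length L1 ℕ.≤ length L2
  Unique-length-≤ L1 L2 u sub = length-≤-by-classes _≡_ _≡_ L1 L2 u sub (λ u v z p q → trans p (sym q))

NumClasses-unique : ∀ {S : Pixel → Set} {R : Pixel → Pixel → Set} {n m} →
  (∀ u v → R u v → R v u) → (∀ u v w → R u v → R v w → R u w) →
  NumClasses S R n → NumClasses S R m → n ≡ m
NumClasses-unique {S} {R} sy tr (L1 , refl , a1 , p1 , c1) (L2 , refl , a2 , p2 , c2) =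
  NP.≤-antisym (length-≤-by-classes R R L1 L2 p1 (λ u m → c2 u (All.lookup a1 m)) (λ u v z p q → tr u z v p (sy v z q)))
               (length-≤-by-classes R R L2 L1 p2 (λ u m → c1 u (All.lookup a2 m)) (λ u v z p q → tr u z v p (sy v z q)))

_≟ᵖ_ : (u v : Pixel) → Dec (u ≡ v)
_≟ᵖ_ = ≡-dec ZP._≟_ ZP._≟_

AllPairs-restrict : ∀ {S : Pixel → Set} {Q Q' : Pixel → Pixel → Set} {L} → All S L → AllPairs Q L →
  (∀ u v → S u → S v → Q u v → Q' u v) → AllPairs Q' L
AllPairs-restrict [] [] f = []
AllPairs-restrict (su ∷ sl) (qs ∷ ap) f = All.zipWith (λ { (sv , q) → f _ _ su sv q }) (sl , qs) ∷ AllPairs-restrict sl ap f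

All-remove : ∀ {P : Pixel → Set} pre z post → All P (pre ++ z ∷ post) → All P (pre ++ post)
All-remove [] z post (_ ∷ a) = a
All-remove (x ∷ pre) z post (p ∷ a) = p ∷ All-remove pre z post a

AllPairs-remove : ∀ {Q : Pixel → Pixel → Set} pre z post → AllPairs Q (pre ++ z ∷ post) → AllPairs Q (pre ++ post)
AllPairs-remove [] z post (_ ∷ a) = a
AllPairs-remove (x ∷ pre) z post (p ∷ a) = All-remove pre z post p ∷ AllPairs-remove pre z post a

AllPairs-middle : ∀ {Q : Pixel → Pixel → Set} pre z post → AllPairs Q (pre ++ z ∷ post) →
  ∀ u → u ∈ pre ++ post → Q u z ⊎ Q z u
AllPairs-middle [] z post (p ∷ a) u m = inj₂ (All.lookup p m)
AllPairs-middle (x ∷ pre) z post (p ∷ a) u (here refl) = inj₁ (All.lookup p (∈-++⁺ʳ pre (here refl)))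
AllPairs-middle (x ∷ pre) z post (p ∷ a) u (there m) = AllPairs-middle pre z post a u m

open import Data.List.Membership.DecPropositional _≟ᵖ_ using (_∈?_)

Conn-mono : ∀ {S S' : Pixel → Set} {adj u v} → (∀ y → S y → S' y) → Conn S adj u v → Conn S' adj u v
Conn-mono f ε = ε
Conn-mono f ((s1 , s2 , a) ◅ r) = (f _ s1 , f _ s2 , a) ◅ Conn-mono f r

Conn-from-outside : ∀ {S : Pixel → Set} {adj u v} → Conn S adj u v → ¬ S u → u ≡ v
Conn-from-outside ε _ = refl
Conn-from-outside ((s1 , _ , _) ◅ _) ns = ⊥-elim (ns s1)

Conn-to-outside : ∀ {S : Pixel → Set} {adj u v} → Conn S adj u v → ¬ S v → u ≡ v
Conn-to-outside ε _ = refl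
Conn-to-outside ((_ , s2 , _) ◅ r) ns with Conn-to-outside r ns
... | refl = ⊥-elim (ns s2)

Conn-step : ∀ {S : Pixel → Set} {adj u v} → S u → S v → adj u v → Conn S adj u v
Conn-step su sv a = (su , sv , a) ◅ ε

Adj1-sym : ∀ u v → Adj1 u v → Adj1 v u
Adj1-sym (a , b) (a' , b') p rewrite ZP.∣i-j∣≡∣j-i∣ a' a | ZP.∣i-j∣≡∣j-i∣ b' b = p

Adj0-sym : ∀ u v → Adj0 u v → Adj0 v u
Adj0-sym (a , b) (a' , b') (p , q) rewrite ZP.∣i-j∣≡∣j-i∣ a' a | ZP.∣i-j∣≡∣j-i∣ b' b = p , q

Conn1-sym : ∀ {S : Pixel → Set} {u v} → Conn S Adj1 u v → Conn S Adj1 v u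
Conn1-sym = reverse (λ {x} {y} r → proj₁ (proj₂ r) , proj₁ r , Adj1-sym x y (proj₂ (proj₂ r)))

Conn0-sym : ∀ {S : Pixel → Set} {u v} → Conn S Adj0 u v → Conn S Adj0 v u
Conn0-sym = reverse (λ {x} {y} r → proj₁ (proj₂ r) , proj₁ r , Adj0-sym x y (proj₂ (proj₂ r)))

Components : Obj → ℕ → Set
Components D n = NumClasses (λ y → y ∈ D) (Comp0 D) n

Holes : Obj → ℕ → Set
Holes D n = NumClasses (InHole D) (CompCompl1 D) n

Components-unique : ∀ {D m n} → Components D m → Components D n → m ≡ n
Components-unique = NumClasses-unique (λ _ _ → Conn0-sym) (λ _ _ _ → _◅◅_)

Holes-unique : ∀ {D m n} → Holes D m → Holes D n → m ≡ n
Holes-unique = NumClasses-unique (λ _ _ → Conn1-sym) (λ _ _ _ → _◅◅_)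

Adj1-right : ∀ p q → Adj1 (p , q) (p + 1ℤ , q)
Adj1-right p q rewrite i-[i+j]≡-j p 1ℤ | ZP.+-inverseʳ q = refl

Adj1-up : ∀ p q → Adj1 (p , q) (p , q + 1ℤ)
Adj1-up p q rewrite i-[i+j]≡-j q 1ℤ | ZP.+-inverseʳ p = refl

i+n+1≡i+[1+n] : ∀ p n → (p + + n) + 1ℤ ≡ p + + suc n
i+n+1≡i+[1+n] p n = ZS.solve 2 (λ p k → (p ZS.:+ k) ZS.:+ ZS.con 1ℤ ZS.:= p ZS.:+ (ZS.con 1ℤ ZS.:+ k)) refl p (+ n)

line-Conn-forward : ∀ (S : Pixel → Set) (f : ℤ → Pixel) → (∀ z → Adj1 (f z) (f (z + 1ℤ))) → (∀ z → S (f z)) →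
  ∀ z n → Conn S Adj1 (f z) (f (z + + n))
line-Conn-forward S f adj s z zero rewrite ZP.+-identityʳ z = ε
line-Conn-forward S f adj s z (suc n) = line-Conn-forward S f adj s z n ◅◅
  subst (λ w → Conn S Adj1 (f (z + + n)) (f w)) (i+n+1≡i+[1+n] z n) (Conn-step (s _) (s _) (adj _))

line-Conn : ∀ (S : Pixel → Set) (f : ℤ → Pixel) → (∀ z → Adj1 (f z) (f (z + 1ℤ))) → (∀ z → S (f z)) →
  ∀ z z' → Conn S Adj1 (f z) (f z')
line-Conn S f adj s z z' with z' - z in eq
... | + n = subst (λ w → Conn S Adj1 (f z) (f w)) (trans (cong (λ w → z + w) (sym eq)) (ZS.solve 2 (λ z z' → z ZS.:+ (z' ZS.:- z) ZS.:= z') refl z z'))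
              (line-Conn-forward S f adj s z n)
... | -[1+ n ] = Conn1-sym (subst (λ w → Conn S Adj1 (f z') (f w)) (trans (cong (λ w → z' + w) (trans (cong -_ (sym eq)) (ZS.solve 2 (λ z z' → ZS.:- (z' ZS.:- z) ZS.:= z ZS.:- z') refl z z'))) (ZS.solve 2 (λ z z' → z' ZS.:+ (z ZS.:- z') ZS.:= z) refl z z'))
              (line-Conn-forward S f adj s z' (suc n)))

data Off : Set where
  M1 Z0 P1 : Off

offset : Off → ℤ
offset M1 = -[1+ 0 ]
offset Z0 = + 0
offset P1 = + 1

shift : ℤ → Off → ℤ
shift a M1 = a - 1ℤ
shift a Z0 = a
shift a P1 = a + 1ℤ

shift≡+offset : ∀ a o → shift a o ≡ a + offset o
shift≡+offset a M1 = refl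
shift≡+offset a Z0 = sym (ZP.+-identityʳ a)
shift≡+offset a P1 = refl

shift-shift : ∀ a o o' → shift a o - shift a o' ≡ offset o - offset o'
shift-shift a o o' rewrite shift≡+offset a o | shift≡+offset a o' = [i+j]-[i+k]≡j-k a (offset o) (offset o')

nbr : ℤ → ℤ → Off → Off → Pixel
nbr a b o1 o2 = (shift a o1 , shift b o2)

Adj0-nbr : ∀ a b o1 o2 o3 o4 → {T ((∣ offset o1 - offset o3 ∣ ℕ.≤ᵇ 1) ∧ (∣ offset o2 - offset o4 ∣ ℕ.≤ᵇ 1))} →
  Adj0 (nbr a b o1 o2) (nbr a b o3 o4)
Adj0-nbr a b o1 o2 o3 o4 {t} rewrite shift-shift a o1 o3 | shift-shift b o2 o4 = lem _ _ t
  where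
  lem : ∀ m n → T ((m ℕ.≤ᵇ 1) ∧ (n ℕ.≤ᵇ 1)) → (m ℕ.≤ 1) × (n ℕ.≤ 1)
  lem zero zero _ = z≤n , z≤n
  lem zero (suc zero) _ = z≤n , s≤s z≤n
  lem (suc zero) zero _ = s≤s z≤n , z≤n
  lem (suc zero) (suc zero) _ = s≤s z≤n , s≤s z≤n
  lem zero (suc (suc n)) ()
  lem (suc zero) (suc (suc n)) ()
  lem (suc (suc m)) zero ()
  lem (suc (suc m)) (suc n) ()

Adj1-nbr : ∀ a b o1 o2 o3 o4 → {T ((∣ offset o1 - offset o3 ∣ ℕ.+ ∣ offset o2 - offset o4 ∣) ℕ.≡ᵇ 1)} →
  Adj1 (nbr a b o1 o2) (nbr a b o3 o4)
Adj1-nbr a b o1 o2 o3 o4 {t} rewrite shift-shift a o1 o3 | shift-shift b o2 o4 = lem _ t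
  where
  lem : ∀ m → T (m ℕ.≡ᵇ 1) → m ≡ 1
  lem (suc zero) _ = refl
  lem zero ()
  lem (suc (suc m)) ()

∣i-j∣≤1⇒shift : ∀ {p a} → ∣ p - a ∣ ℕ.≤ 1 → Σ Off λ o → p ≡ shift a o
∣i-j∣≤1⇒shift {p} {a} h with ∣i∣≤1-cases (p - a) h
... | inj₁ e = M1 , i-j≡k⇒i≡j+k p a _ e
... | inj₂ (inj₁ e) = Z0 , trans (i-j≡k⇒i≡j+k p a _ e) (ZP.+-identityʳ a)
... | inj₂ (inj₂ e) = P1 , i-j≡k⇒i≡j+k p a _ e

Adj0⇒nbr : ∀ y a b → Adj0 y (a , b) → Σ Off λ o1 → Σ Off λ o2 → y ≡ nbr a b o1 o2
Adj0⇒nbr (p , q) a b (h1 , h2) with ∣i-j∣≤1⇒shift {p} {a} h1 | ∣i-j∣≤1⇒shift {q} {b} h2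
... | o1 , refl | o2 , refl = o1 , o2 , refl

Adj1⇒nbr : ∀ y a b → Adj1 y (a , b) → (y ≡ nbr a b M1 Z0) ⊎ (y ≡ nbr a b P1 Z0) ⊎ (y ≡ nbr a b Z0 P1) ⊎ (y ≡ nbr a b Z0 M1)
Adj1⇒nbr (p , q) a b h with ∣i∣+∣j∣≡1-cases (p - a) (q - b) h
... | inj₁ (inj₁ e1 , e2) rewrite i-j≡k⇒i≡j+k p a _ e1 | i-j≡k⇒i≡j+k q b _ e2 | ZP.+-identityʳ b = inj₁ refl
... | inj₁ (inj₂ e1 , e2) rewrite i-j≡k⇒i≡j+k p a _ e1 | i-j≡k⇒i≡j+k q b _ e2 | ZP.+-identityʳ b = inj₂ (inj₁ refl)
... | inj₂ (e1 , inj₂ e2) rewrite i-j≡k⇒i≡j+k p a _ e1 | i-j≡k⇒i≡j+k q b _ e2 | ZP.+-identityʳ a = inj₂ (inj₂ (inj₁ refl))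
... | inj₂ (e1 , inj₁ e2) rewrite i-j≡k⇒i≡j+k p a _ e1 | i-j≡k⇒i≡j+k q b _ e2 | ZP.+-identityʳ a = inj₂ (inj₂ (inj₂ refl))

module PathsThroughPoint (Big Small : Pixel → Set) (adj : Pixel → Pixel → Set) (x : Pixel)
  (big→ : ∀ y → Big y → y ≡ x ⊎ Small y) (small→ : ∀ y → Small y → Big y) (nsx : ¬ Small x)
  (asym : ∀ u v → adj u v → adj v u) (csym : ∀ {u v} → Conn Small adj u v → Conn Small adj v u) where

  ViaNeighbour : Pixel → Set
  ViaNeighbour y = Σ Pixel λ nb → Small nb × adj nb x × Conn Small adj y nb

  ViaPoint : Pixel → Set
  ViaPoint y = y ≡ x ⊎ ViaNeighbour y

  split : ∀ {r s} → Conn Big adj r s → Conn Small adj r s ⊎ (ViaPoint r × ViaPoint s)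
  split ε = inj₁ ε
  split {r} {s} ((br , br1 , a) ◅ rest) with big→ _ br | big→ _ br1 | split rest
  ... | inj₁ refl | _ | inj₂ (_ , ts) = inj₂ (inj₁ refl , ts)
  ... | inj₁ refl | inj₁ refl | inj₁ p with Conn-from-outside p nsx
  ...   | refl = inj₂ (inj₁ refl , inj₁ refl)
  split {r} {s} ((br , br1 , a) ◅ rest) | inj₁ refl | inj₂ sr1 | inj₁ p = inj₂ (inj₁ refl , inj₂ (_ , sr1 , asym _ _ a , csym p))
  split {r} {s} ((br , br1 , a) ◅ rest) | inj₂ sr | inj₁ refl | inj₁ p with Conn-from-outside p nsx
  ...   | refl = inj₂ (inj₂ (r , sr , a , ε) , inj₁ refl)
  split {r} {s} ((br , br1 , a) ◅ rest) | inj₂ sr | inj₁ refl | inj₂ (_ , ts) = inj₂ (inj₂ (r , sr , a , ε) , ts)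
  split {r} {s} ((br , br1 , a) ◅ rest) | inj₂ sr | inj₂ sr1 | inj₁ p = inj₁ ((sr , sr1 , a) ◅ p)
  split {r} {s} ((br , br1 , a) ◅ rest) | inj₂ sr | inj₂ sr1 | inj₂ (inj₁ refl , ts) = ⊥-elim (nsx sr1)
  split {r} {s} ((br , br1 , a) ◅ rest) | inj₂ sr | inj₂ sr1 | inj₂ (inj₂ (nb , snb , anb , c) , ts) =
    inj₂ (inj₂ (nb , snb , anb , (sr , sr1 , a) ◅ c) , ts)

range : ℤ → ℕ → List ℤ
range lo n = map (λ k → lo + + k) (upTo n)

range-unique : ∀ lo n → Unique (range lo n)
range-unique lo n = UP.map⁺ (λ {k} {k'} p → ZP.+-injective (trans (sym ([i+j]-i≡j lo (+ k))) (trans (cong (_- lo) p) ([i+j]-i≡j lo (+ k'))))) (UP.upTo⁺ n)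

∈range : ∀ lo n p → lo ≤ p → p ≤ lo + + n → p ∈ range lo (suc n)
∈range lo n p l h = subst (_∈ range lo (suc n)) peq (∈-map⁺ (λ k → lo + + k) (∈-upTo⁺ klt))
  where
  k : ℕ
  k = ∣ p - lo ∣
  nn : + 0 ≤ p - lo
  nn = subst (_≤ p - lo) (ZP.+-inverseʳ lo) (ZP.+-monoˡ-≤ (- lo) l)
  keq : + k ≡ p - lo
  keq = ZP.0≤i⇒+∣i∣≡i nn
  peq : lo + + k ≡ p
  peq = trans (cong (λ w → lo + w) keq) (ZS.solve 2 (λ l p → l ZS.:+ (p ZS.:- l) ZS.:= p) refl lo p)
  klt : k ℕ.< suc n
  klt = s≤s (ZP.drop‿+≤+ (subst (_≤ + n) (sym keq) (subst (p - lo ≤_) ([i+j]-i≡j lo (+ n)) (ZP.+-monoˡ-≤ (- lo) h))))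

InR : ℕ → ℤ → Set
InR M p = (- (+ M) ≤ p) × (p ≤ + M)

InBox : ℕ → Pixel → Set
InBox M (p , q) = InR M p × InR M q

inR? : ∀ M p → Dec (InR M p)
inR? M p with (- (+ M)) ZP.≤? p | p ZP.≤? (+ M)
... | yes a | yes b = yes (a , b)
... | no a | _ = no (λ z → a (proj₁ z))
... | yes _ | no b = no (λ z → b (proj₂ z))

boxRange : ℕ → List ℤ
boxRange M = range (- (+ M)) (suc (M ℕ.+ M))

∈boxRange : ∀ M p → InR M p → p ∈ boxRange M
∈boxRange M p (l , h) = ∈range (- (+ M)) (M ℕ.+ M) p l
  (subst (p ≤_) (trans (ZS.solve 1 (λ m → m ZS.:= (ZS.:- m) ZS.:+ (m ZS.:+ m)) refl (+ M)) (cong (λ w → (- (+ M)) + w) (sym (ZP.pos-+ M M)))) h)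

box : ℕ → List Pixel
box M = cartesianProduct (boxRange M) (boxRange M)

∈box : ∀ M y → InBox M y → y ∈ box M
∈box M (p , q) (ip , iq) = ∈-cartesianProduct⁺ (∈boxRange M p ip) (∈boxRange M q iq)

Bounded : ℕ → Obj → Set
Bounded M D = ∀ y → y ∈ D → InBox M y

Far : ℕ → Pixel
Far M = (+ suc M , + suc M)

1+M∉range : ∀ M → ¬ InR M (+ suc M)
1+M∉range M (_ , h) = NP.<-irrefl refl (ZP.drop‿+≤+ h)

fresh-column : ∀ (L : List Pixel) → Σ ℤ λ p → ∀ z → z ∈ L → ¬ proj₁ z ≡ p
fresh-column L = + suc (tot L) , λ z m e → NP.<-irrefl refl (NP.≤-trans (s≤s (bound L z m)) (NP.≤-reflexive (sym (cong ∣_∣ e))))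
  where
  tot : List Pixel → ℕ
  tot [] = 0
  tot ((p , _) ∷ L) = ∣ p ∣ ℕ.+ tot L
  bound : ∀ L z → z ∈ L → ∣ proj₁ z ∣ ℕ.≤ tot L
  bound ((p , _) ∷ L) z (here refl) = NP.m≤m+n ∣ p ∣ (tot L)
  bound ((p , _) ∷ L) z (there m) = NP.≤-trans (bound L z m) (NP.m≤n+m (tot L) ∣ p ∣)

module Exterior (M : ℕ) (D : Obj) (bnd : Bounded M D) where
  Sc : Pixel → Set
  Sc = Compl D
  Conn1ᶜ : Pixel → Pixel → Set
  Conn1ᶜ = Conn Sc Adj1
  Outside : Pixel → Set
  Outside y = Conn1ᶜ y (Far M)
  Finite : Pixel → Set
  Finite y = Σ (List Pixel) λ L → ∀ z → Conn1ᶜ y z → z ∈ L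

  farColumn∉ : ∀ q → (+ suc M , q) ∉ D
  farColumn∉ q m = 1+M∉range M (proj₁ (bnd _ m))

  farRow∉ : ∀ p → (p , + suc M) ∉ D
  farRow∉ p m = 1+M∉range M (proj₂ (bnd _ m))

  row-Conn : ∀ q → (∀ p → (p , q) ∉ D) → ∀ p p' → Conn1ᶜ (p , q) (p' , q)
  row-Conn q e p p' = line-Conn Sc (λ z → (z , q)) (λ z → Adj1-right z q) e p p'

  column-Conn : ∀ p → (∀ q → (p , q) ∉ D) → ∀ q q' → Conn1ᶜ (p , q) (p , q')
  column-Conn p e q q' = line-Conn Sc (λ z → (p , z)) (λ z → Adj1-up p z) e q q'

  emptyRow⇒Outside : ∀ q → (∀ p → (p , q) ∉ D) → ∀ p → Outside (p , q)
  emptyRow⇒Outside q e p = row-Conn q e p (+ suc M) ◅◅ column-Conn (+ suc M) farColumn∉ q (+ suc M)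

  emptyColumn⇒Outside : ∀ p → (∀ q → (p , q) ∉ D) → ∀ q → Outside (p , q)
  emptyColumn⇒Outside p e q = column-Conn p e q (+ suc M) ◅◅ row-Conn (+ suc M) farRow∉ p (+ suc M)

  ¬InBox⇒Outside : ∀ y → ¬ InBox M y → Outside y
  ¬InBox⇒Outside (p , q) nb with inR? M p
  ... | no np = emptyColumn⇒Outside p (λ q' m → np (proj₁ (bnd _ m))) q
  ... | yes ip = emptyRow⇒Outside q (λ p' m → nb (ip , proj₂ (bnd _ m))) p

  Outside⇒¬Finite : ∀ y → Outside y → ¬ Finite y
  Outside⇒¬Finite y inf (L , f) with fresh-column L
  ... | p , fr = fr _ (f _ (inf ◅◅ row-Conn (+ suc M) farRow∉ (+ suc M) p)) refl

  ¬Outside⇒Finite : ∀ y → ¬ Outside y → Finite y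
  ¬Outside⇒Finite y ni = box M , λ z c → h z c
    where
    h : ∀ z → Conn1ᶜ y z → z ∈ box M
    h (p , q) c with inR? M p | inR? M q
    ... | yes a | yes b = ∈box M (p , q) (a , b)
    ... | no a | _ = ⊥-elim (ni (c ◅◅ ¬InBox⇒Outside _ (λ z → a (proj₁ z))))
    ... | yes _ | no b = ⊥-elim (ni (c ◅◅ ¬InBox⇒Outside _ (λ z → b (proj₂ z))))

∣i∣≤M⇒InR : ∀ p M → ∣ p ∣ ℕ.≤ M → InR M p
∣i∣≤M⇒InR (+ n) zero le = ℤ.+≤+ z≤n , ℤ.+≤+ le
∣i∣≤M⇒InR (+ n) (suc m) le = ℤ.-≤+ , ℤ.+≤+ le
∣i∣≤M⇒InR -[1+ n ] (suc m) (s≤s le) = ℤ.-≤- le , ℤ.-≤+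

boundingBox : ∀ (D : Obj) → Σ ℕ λ M → Bounded M D
boundingBox D = tot D , λ y m → bd D y m
  where
  tot : Obj → ℕ
  tot [] = 0
  tot ((p , q) ∷ E) = (∣ p ∣ ℕ.+ ∣ q ∣) ℕ.+ tot E
  bd : ∀ E y → y ∈ E → InBox (tot E) y
  bd ((p , q) ∷ E) y (here refl) =
    ∣i∣≤M⇒InR p _ (NP.≤-trans (NP.m≤m+n ∣ p ∣ ∣ q ∣) (NP.m≤m+n _ (tot E))) ,
    ∣i∣≤M⇒InR q _ (NP.≤-trans (NP.m≤n+m ∣ q ∣ ∣ p ∣) (NP.m≤m+n _ (tot E)))
  bd ((p , q) ∷ E) y (there m) with bd E y m
  ... | (u1 , u2) , (v1 , v2) = (wk u1 , wk' u2) , (wk v1 , wk' v2)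
    where
    k : ℕ
    k = ∣ p ∣ ℕ.+ ∣ q ∣
    wk : ∀ {i} → - (+ tot E) ≤ i → - (+ (k ℕ.+ tot E)) ≤ i
    wk l = ZP.≤-trans (ZP.neg-mono-≤ (ℤ.+≤+ (NP.m≤n+m (tot E) k))) l
    wk' : ∀ {i} → i ≤ + tot E → i ≤ + (k ℕ.+ tot E)
    wk' l = ZP.≤-trans l (ℤ.+≤+ (NP.m≤n+m (tot E) k))

inGridRange : ℕ → ℤ → Bool
inGridRange M i = b≤ -[1+ M ] i ∧ b≤ i (+ M)

inGridBox : ℕ → GridPoint → Bool
inGridBox M (i , j) = inGridRange M i ∧ inGridRange M j

negM1 : ∀ M → - (+ M) - 1ℤ ≡ -[1+ M ]
negM1 M = ZS.solve 1 (λ m → ZS.:- m ZS.:- ZS.con 1ℤ ZS.:= ZS.:- (ZS.con 1ℤ ZS.:+ m)) refl (+ M)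

negM-le : ∀ M → -[1+ M ] ≤ - (+ M)
negM-le zero = ℤ.-≤+
negM-le (suc m) = ℤ.-≤- (NP.n≤1+n m)

inGridRange-intro : ∀ M i → -[1+ M ] ≤ i → i ≤ + M → inGridRange M i ≡ true
inGridRange-intro M i l h rewrite ≤⇒b≤ l | ≤⇒b≤ h = refl

InR⇒inGridRange : ∀ M i → InR M i → inGridRange M i ≡ true
InR⇒inGridRange M i (l , h) = inGridRange-intro M i (ZP.≤-trans (negM-le M) l) h

InR⇒inGridRange-1 : ∀ M i → InR M i → inGridRange M (i - 1ℤ) ≡ true
InR⇒inGridRange-1 M i (l , h) = inGridRange-intro M _ (subst (_≤ i - 1ℤ) (negM1 M) (ZP.+-monoˡ-≤ (- 1ℤ) l)) (ZP.i≤j⇒i-k≤j 1ℤ h)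

InR+1⇒inGridRange : ∀ M i → InR M (i + 1ℤ) → inGridRange M i ≡ true
InR+1⇒inGridRange M i (l , h) = inGridRange-intro M _ (subst₂ _≤_ (negM1 M) (i+1-1≡i i) (ZP.+-monoˡ-≤ (- 1ℤ) l)) (ZP.≤-trans (ZP.i≤i+j i 1ℤ) h)

gridRange : ℕ → List ℤ
gridRange M = range -[1+ M ] (suc (suc (M ℕ.+ M)))

gridBox : ℕ → List GridPoint
gridBox M = cartesianProduct (gridRange M) (gridRange M)

∈gridRange : ∀ M i → inGridRange M i ≡ true → i ∈ gridRange M
∈gridRange M i p with ∧≡true⇒ {b≤ -[1+ M ] i} p
... | p1 , p2 = ∈range -[1+ M ] (suc (M ℕ.+ M)) i (b≤⇒≤ p1)
  (subst (i ≤_) (trans (ZS.solve 1 (λ m → m ZS.:= ZS.:- (ZS.con 1ℤ ZS.:+ m) ZS.:+ (ZS.con 1ℤ ZS.:+ (m ZS.:+ m))) refl (+ M))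
                       (cong (λ w → -[1+ M ] + (1ℤ + w)) (sym (ZP.pos-+ M M)))) (b≤⇒≤ p2))

∈gridBox : ∀ M g → inGridBox M g ≡ true → g ∈ gridBox M
∈gridBox M (i , j) p with ∧≡true⇒ {inGridRange M i} p
... | p1 , p2 = ∈-cartesianProduct⁺ (∈gridRange M i p1) (∈gridRange M j p2)

sumL : (GridPoint → ℤ) → List GridPoint → ℤ
sumL f [] = + 0
sumL f (g ∷ gs) = f g + sumL f gs

sumL-+ : ∀ f h gs → sumL (λ g → f g + h g) gs ≡ sumL f gs + sumL h gs
sumL-+ f h [] = refl
sumL-+ f h (g ∷ gs) rewrite sumL-+ f h gs = ZS.solve 4 (λ a b c d → (a ZS.:+ b) ZS.:+ (c ZS.:+ d) ZS.:= (a ZS.:+ c) ZS.:+ (b ZS.:+ d)) refl (f g) (h g) (sumL f gs) (sumL h gs)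

sumL-difference : ∀ f h gs → sumL (λ g → f g - h g) gs ≡ sumL f gs - sumL h gs
sumL-difference f h [] = refl
sumL-difference f h (g ∷ gs) rewrite sumL-difference f h gs = ZS.solve 4 (λ a b c d → (a ZS.:- b) ZS.:+ (c ZS.:- d) ZS.:= (a ZS.:+ c) ZS.:- (b ZS.:+ d)) refl (f g) (h g) (sumL f gs) (sumL h gs)

sumL-*z : ∀ f z gs → sumL (λ g → f g * z) gs ≡ sumL f gs * z
sumL-*z f z [] = refl
sumL-*z f z (g ∷ gs) rewrite sumL-*z f z gs = sym (ZP.*-distribʳ-+ z (f g) (sumL f gs))

sumL-cong : ∀ f h gs → (∀ g → f g ≡ h g) → sumL f gs ≡ sumL h gs
sumL-cong f h [] p = refl
sumL-cong f h (g ∷ gs) p rewrite p g | sumL-cong f h gs p = refl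

sumL-zero : ∀ f gs → (∀ g → f g ≡ + 0) → sumL f gs ≡ + 0
sumL-zero f [] p = refl
sumL-zero f (g ∷ gs) p rewrite p g | sumL-zero f gs p = refl

indicator : GridPoint → GridPoint → ℤ
indicator g c = if ⌊ g ≟ᵖ c ⌋ then + 1 else + 0

sumL-zero-on : ∀ f gs → (∀ g → g ∈ gs → f g ≡ + 0) → sumL f gs ≡ + 0
sumL-zero-on f [] p = refl
sumL-zero-on f (g ∷ gs) p rewrite p g (here refl) | sumL-zero-on f gs (λ g' m → p g' (there m)) = refl

indicator-≢ : ∀ g c → ¬ g ≡ c → indicator g c ≡ + 0
indicator-≢ g c ne with g ≟ᵖ c
... | yes e = ⊥-elim (ne e)
... | no _ = refl

indicator-refl : ∀ c → indicator c c ≡ + 1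
indicator-refl c with c ≟ᵖ c
... | yes _ = refl
... | no n = ⊥-elim (n refl)

sumL-indicator : ∀ c gs → Unique gs → c ∈ gs → sumL (λ g → indicator g c) gs ≡ + 1
sumL-indicator c (g ∷ gs) (hd ∷ u) (here refl) rewrite indicator-refl c | sumL-zero-on (λ g' → indicator g' c) gs (λ g' m → indicator-≢ g' c (λ e → All.lookup hd m (sym e))) = refl
sumL-indicator c (g ∷ gs) (hd ∷ u) (there m) rewrite indicator-≢ g c (λ e → All.lookup hd m e) | sumL-indicator c gs u m = refl

sumL-update4 : ∀ (f f' : GridPoint → ℤ) gs → Unique gs → ∀ c1 c2 c3 c4 → c1 ∈ gs → c2 ∈ gs → c3 ∈ gs → c4 ∈ gs →
  ¬ c1 ≡ c2 → ¬ c1 ≡ c3 → ¬ c1 ≡ c4 → ¬ c2 ≡ c3 → ¬ c2 ≡ c4 → ¬ c3 ≡ c4 →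
  (∀ g → ¬ g ≡ c1 → ¬ g ≡ c2 → ¬ g ≡ c3 → ¬ g ≡ c4 → f g ≡ f' g) →
  sumL f gs ≡ sumL f' gs + (((f c1 - f' c1) + (f c2 - f' c2)) + ((f c3 - f' c3) + (f c4 - f' c4)))
sumL-update4 f f' gs u c1 c2 c3 c4 m1 m2 m3 m4 n12 n13 n14 n23 n24 n34 agree-elsewhere =
  begin
    sumL f gs
  ≡⟨ sym (ZS.solve 2 (λ s t → t ZS.:+ (s ZS.:- t) ZS.:= s) refl (sumL f gs) (sumL f' gs)) ⟩
    sumL f' gs + (sumL f gs - sumL f' gs)
  ≡⟨ cong (λ w → sumL f' gs + w) (sym (sumL-difference f f' gs)) ⟩
    sumL f' gs + sumL δ gs
  ≡⟨ cong (λ w → sumL f' gs + w) (sumL-cong δ _ gs δ-decomposition) ⟩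
    sumL f' gs + sumL (λ g → (indicator g c1 * δ c1 + indicator g c2 * δ c2) + (indicator g c3 * δ c3 + indicator g c4 * δ c4)) gs
  ≡⟨ cong (λ w → sumL f' gs + w) (trans (sumL-+ _ _ gs) (cong₂ _+_ (sumL-+ _ _ gs) (sumL-+ _ _ gs))) ⟩
    sumL f' gs + ((sumL (λ g → indicator g c1 * δ c1) gs + sumL (λ g → indicator g c2 * δ c2) gs) + (sumL (λ g → indicator g c3 * δ c3) gs + sumL (λ g → indicator g c4 * δ c4) gs))
  ≡⟨ cong (λ w → sumL f' gs + w) (cong₂ _+_ (cong₂ _+_ (sumL-indicator*δ c1 m1) (sumL-indicator*δ c2 m2)) (cong₂ _+_ (sumL-indicator*δ c3 m3) (sumL-indicator*δ c4 m4))) ⟩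
    sumL f' gs + ((δ c1 + δ c2) + (δ c3 + δ c4))
  ∎
  where
  open ≡-Reasoning
  only₁ : ∀ d x y z → d ≡ (+ 1 * d + + 0 * x) + (+ 0 * y + + 0 * z)
  only₁ = ZS.solve 4 (λ d x y z → d ZS.:= (ZS.con (+ 1) ZS.:* d ZS.:+ ZS.con (+ 0) ZS.:* x) ZS.:+ (ZS.con (+ 0) ZS.:* y ZS.:+ ZS.con (+ 0) ZS.:* z)) refl
  only₂ : ∀ x d y z → d ≡ (+ 0 * x + + 1 * d) + (+ 0 * y + + 0 * z)
  only₂ = ZS.solve 4 (λ x d y z → d ZS.:= (ZS.con (+ 0) ZS.:* x ZS.:+ ZS.con (+ 1) ZS.:* d) ZS.:+ (ZS.con (+ 0) ZS.:* y ZS.:+ ZS.con (+ 0) ZS.:* z)) refl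
  only₃ : ∀ x y d z → d ≡ (+ 0 * x + + 0 * y) + (+ 1 * d + + 0 * z)
  only₃ = ZS.solve 4 (λ x y d z → d ZS.:= (ZS.con (+ 0) ZS.:* x ZS.:+ ZS.con (+ 0) ZS.:* y) ZS.:+ (ZS.con (+ 1) ZS.:* d ZS.:+ ZS.con (+ 0) ZS.:* z)) refl
  only₄ : ∀ x y z d → d ≡ (+ 0 * x + + 0 * y) + (+ 0 * z + + 1 * d)
  only₄ = ZS.solve 4 (λ x y z d → d ZS.:= (ZS.con (+ 0) ZS.:* x ZS.:+ ZS.con (+ 0) ZS.:* y) ZS.:+ (ZS.con (+ 0) ZS.:* z ZS.:+ ZS.con (+ 1) ZS.:* d)) refl
  δ : GridPoint → ℤ
  δ g = f g - f' g
  sumL-indicator*δ : ∀ c → c ∈ gs → sumL (λ g → indicator g c * δ c) gs ≡ δ c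
  sumL-indicator*δ c m = trans (sumL-*z (λ g → indicator g c) (δ c) gs) (trans (cong (_* δ c) (sumL-indicator c gs u m)) (ZP.*-identityˡ (δ c)))
  δ-decomposition : ∀ g → δ g ≡ (indicator g c1 * δ c1 + indicator g c2 * δ c2) + (indicator g c3 * δ c3 + indicator g c4 * δ c4)
  δ-decomposition g = go (g ≟ᵖ c1) (g ≟ᵖ c2) (g ≟ᵖ c3) (g ≟ᵖ c4)
    where
    go : Dec (g ≡ c1) → Dec (g ≡ c2) → Dec (g ≡ c3) → Dec (g ≡ c4) → δ g ≡ (indicator g c1 * δ c1 + indicator g c2 * δ c2) + (indicator g c3 * δ c3 + indicator g c4 * δ c4)
    go (yes e) _ _ _ rewrite e | indicator-refl c1 | indicator-≢ c1 c2 n12 | indicator-≢ c1 c3 n13 | indicator-≢ c1 c4 n14 = only₁ (δ c1) (δ c2) (δ c3) (δ c4)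
    go (no a) (yes e) _ _ rewrite e | indicator-refl c2 | indicator-≢ c2 c1 (λ z → n12 (sym z)) | indicator-≢ c2 c3 n23 | indicator-≢ c2 c4 n24 = only₂ (δ c1) (δ c2) (δ c3) (δ c4)
    go (no a) (no b) (yes e) _ rewrite e | indicator-refl c3 | indicator-≢ c3 c1 (λ z → n13 (sym z)) | indicator-≢ c3 c2 (λ z → n23 (sym z)) | indicator-≢ c3 c4 n34 = only₃ (δ c1) (δ c2) (δ c3) (δ c4)
    go (no a) (no b) (no c) (yes e) rewrite e | indicator-refl c4 | indicator-≢ c4 c1 (λ z → n14 (sym z)) | indicator-≢ c4 c2 (λ z → n24 (sym z)) | indicator-≢ c4 c3 (λ z → n34 (sym z)) = only₄ (δ c1) (δ c2) (δ c3) (δ c4)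
    go (no a) (no b) (no c) (no d) rewrite indicator-≢ g c1 a | indicator-≢ g c2 b | indicator-≢ g c3 c | indicator-≢ g c4 d | agree-elsewhere g a b c d = ZP.+-inverseʳ (f' g)

toℤ : Bool → ℤ
toℤ true = + 1
toℤ false = + 0

anyB allB diagB : Bool → Bool → Bool → Bool → Bool
anyB p q r s = p ∨ q ∨ r ∨ s
allB p q r s = p ∧ q ∧ r ∧ s
diagB p q r s = (p ∧ s ∧ not q ∧ not r) ∨ (q ∧ r ∧ not p ∧ not s)

ψ : Bool → Bool → Bool → Bool → ℤ
ψ p q r s = (toℤ (anyB p q r s) + toℤ (allB p q r s)) - toℤ (diagB p q r s)

memberᵇ : Obj → Pixel → Bool
memberᵇ D y = ⌊ y ∈? D ⌋

∈⇒memberᵇ : ∀ {D y} → y ∈ D → memberᵇ D y ≡ true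
∈⇒memberᵇ {D} {y} m with y ∈? D
... | yes _ = refl
... | no n = ⊥-elim (n m)

∉⇒memberᵇ-false : ∀ {D y} → y ∉ D → memberᵇ D y ≡ false
∉⇒memberᵇ-false {D} {y} n with y ∈? D
... | yes m = ⊥-elim (n m)
... | no _ = refl

memberᵇ⇒∈ : ∀ {D y} → memberᵇ D y ≡ true → y ∈ D
memberᵇ⇒∈ {D} {y} p with y ∈? D
... | yes m = m
memberᵇ⇒∈ {D} {y} () | no _

Ψ : Obj → GridPoint → ℤ
Ψ D (i , j) = ψ (memberᵇ D (i , j)) (memberᵇ D (i + 1ℤ , j)) (memberᵇ D (i , j + 1ℤ)) (memberᵇ D (i + 1ℤ , j + 1ℤ))

-- The change of ψ at the corners (a , b), (a - 1 , b), (a , b - 1), (a - 1 , b - 1) of x = (a , b)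
-- when x is added, in terms of the membership of L, LL, B, BR; R and the row above x are empty.
Δψ : Bool → Bool → Bool → Bool → ℤ
Δψ l ll bb br =
  ((ψ true false false false - ψ false false false false) + (ψ l true false false - ψ l false false false)) +
  ((ψ bb br true false - ψ bb br false false) + (ψ ll bb l true - ψ ll bb l false))

length-filter≡sumL : ∀ (T : GridPoint → Bool) gs → + length (filter (λ g → T g ≟ᵇ true) gs) ≡ sumL (λ g → toℤ (T g)) gs
length-filter≡sumL T [] = refl
length-filter≡sumL T (g ∷ gs) with T g
... | true = trans (cong (λ w → 1ℤ + w) (length-filter≡sumL T gs)) refl
... | false = trans (length-filter≡sumL T gs) (sym (ZP.+-identityˡ _))

HasSize⇒sumL : ∀ {P : GridPoint → Set} {n} (T : GridPoint → Bool) gs → Unique gs →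
  (∀ g → P g → T g ≡ true) → (∀ g → T g ≡ true → P g) → (∀ g → T g ≡ true → g ∈ gs) →
  HasSize P n → + n ≡ sumL (λ g → toℤ (T g)) gs
HasSize⇒sumL {P} T gs ug toT ofT sup (L , uL , refl , snd , cmp) =
  trans (cong +_ (NP.≤-antisym le1 le2)) (length-filter≡sumL T gs)
  where
  F : List GridPoint
  F = filter (λ g → T g ≟ᵇ true) gs
  le1 : length L ℕ.≤ length F
  le1 = Unique-length-≤ L F uL (λ z m → ∈-filter⁺ (λ g → T g ≟ᵇ true) (sup z (toT z (snd z m))) (toT z (snd z m)))
  le2 : length F ℕ.≤ length L
  le2 = Unique-length-≤ F L (UP.filter⁺ (λ g → T g ≟ᵇ true) ug) (λ z m → cmp z (ofT z (proj₂ (∈-filter⁻ (λ g → T g ≟ᵇ true) {xs = gs} m))))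

isVertexᵇ isBlockᵇ isTunnelᵇ : Obj → GridPoint → Bool
isVertexᵇ D (i , j) = anyB (memberᵇ D (i , j)) (memberᵇ D (i + 1ℤ , j)) (memberᵇ D (i , j + 1ℤ)) (memberᵇ D (i + 1ℤ , j + 1ℤ))
isBlockᵇ D (i , j) = allB (memberᵇ D (i , j)) (memberᵇ D (i + 1ℤ , j)) (memberᵇ D (i , j + 1ℤ)) (memberᵇ D (i + 1ℤ , j + 1ℤ))
isTunnelᵇ D (i , j) = diagB (memberᵇ D (i , j)) (memberᵇ D (i + 1ℤ , j)) (memberᵇ D (i , j + 1ℤ)) (memberᵇ D (i + 1ℤ , j + 1ℤ))

anyB-true₁ : ∀ {p q r s} → p ≡ true → anyB p q r s ≡ true
anyB-true₁ refl = refl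
anyB-true₂ : ∀ {p q r s} → q ≡ true → anyB p q r s ≡ true
anyB-true₂ {true} refl = refl
anyB-true₂ {false} refl = refl
anyB-true₃ : ∀ {p q r s} → r ≡ true → anyB p q r s ≡ true
anyB-true₃ {true} refl = refl
anyB-true₃ {false} {true} refl = refl
anyB-true₃ {false} {false} refl = refl
anyB-true₄ : ∀ {p q r s} → s ≡ true → anyB p q r s ≡ true
anyB-true₄ {true} refl = refl
anyB-true₄ {false} {true} refl = refl
anyB-true₄ {false} {false} {true} refl = refl
anyB-true₄ {false} {false} {false} refl = refl

memberᵇ-false⇒∉ : ∀ {D y} → memberᵇ D y ≡ false → y ∉ D
memberᵇ-false⇒∉ p m = t≢f (trans (sym (∈⇒memberᵇ m)) p)
  where
  t≢f : ¬ true ≡ false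
  t≢f ()

IsVertex⇒isVertexᵇ : ∀ D g → IsVertex D g → isVertexᵇ D g ≡ true
IsVertex⇒isVertexᵇ D (i , j) ((a' , b') , m , inj₁ refl , inj₁ refl) = anyB-true₁ {memberᵇ D (i , j)} {memberᵇ D (i + 1ℤ , j)} {memberᵇ D (i , j + 1ℤ)} {memberᵇ D (i + 1ℤ , j + 1ℤ)} (∈⇒memberᵇ m)
IsVertex⇒isVertexᵇ D (i , j) ((a' , b') , m , inj₂ refl , inj₁ refl) = anyB-true₂ {memberᵇ D (i , j)} {memberᵇ D (i + 1ℤ , j)} {memberᵇ D (i , j + 1ℤ)} {memberᵇ D (i + 1ℤ , j + 1ℤ)} (∈⇒memberᵇ m)
IsVertex⇒isVertexᵇ D (i , j) ((a' , b') , m , inj₁ refl , inj₂ refl) = anyB-true₃ {memberᵇ D (i , j)} {memberᵇ D (i + 1ℤ , j)} {memberᵇ D (i , j + 1ℤ)} {memberᵇ D (i + 1ℤ , j + 1ℤ)} (∈⇒memberᵇ m)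
IsVertex⇒isVertexᵇ D (i , j) ((a' , b') , m , inj₂ refl , inj₂ refl) = anyB-true₄ {memberᵇ D (i , j)} {memberᵇ D (i + 1ℤ , j)} {memberᵇ D (i , j + 1ℤ)} {memberᵇ D (i + 1ℤ , j + 1ℤ)} (∈⇒memberᵇ m)

isVertexᵇ⇒IsVertex : ∀ D g → isVertexᵇ D g ≡ true → IsVertex D g
isVertexᵇ⇒IsVertex D (i , j) p with memberᵇ D (i , j) in e1 | memberᵇ D (i + 1ℤ , j) in e2 | memberᵇ D (i , j + 1ℤ) in e3 | memberᵇ D (i + 1ℤ , j + 1ℤ) in e4
... | true | _ | _ | _ = (i , j) , memberᵇ⇒∈ e1 , inj₁ refl , inj₁ refl
... | false | true | _ | _ = (i + 1ℤ , j) , memberᵇ⇒∈ e2 , inj₂ refl , inj₁ refl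
... | false | false | true | _ = (i , j + 1ℤ) , memberᵇ⇒∈ e3 , inj₁ refl , inj₂ refl
... | false | false | false | true = (i + 1ℤ , j + 1ℤ) , memberᵇ⇒∈ e4 , inj₂ refl , inj₂ refl
isVertexᵇ⇒IsVertex D (i , j) () | false | false | false | false

Block⇒isBlockᵇ : ∀ D g → Block D g → isBlockᵇ D g ≡ true
Block⇒isBlockᵇ D (i , j) (m1 , m2 , m3 , m4) rewrite ∈⇒memberᵇ m1 | ∈⇒memberᵇ m2 | ∈⇒memberᵇ m3 | ∈⇒memberᵇ m4 = refl

isBlockᵇ⇒Block : ∀ D g → isBlockᵇ D g ≡ true → Block D g
isBlockᵇ⇒Block D (i , j) p with memberᵇ D (i , j) in e1 | memberᵇ D (i + 1ℤ , j) in e2 | memberᵇ D (i , j + 1ℤ) in e3 | memberᵇ D (i + 1ℤ , j + 1ℤ) in e4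
... | true | true | true | true = memberᵇ⇒∈ e1 , memberᵇ⇒∈ e2 , memberᵇ⇒∈ e3 , memberᵇ⇒∈ e4
isBlockᵇ⇒Block D (i , j) () | false | _ | _ | _
isBlockᵇ⇒Block D (i , j) () | true | false | _ | _
isBlockᵇ⇒Block D (i , j) () | true | true | false | _
isBlockᵇ⇒Block D (i , j) () | true | true | true | false

Tunnel⇒isTunnelᵇ : ∀ D g → Tunnel D g → isTunnelᵇ D g ≡ true
Tunnel⇒isTunnelᵇ D (i , j) (inj₁ (m1 , m4 , n2 , n3)) rewrite ∈⇒memberᵇ m1 | ∈⇒memberᵇ m4 | ∉⇒memberᵇ-false n2 | ∉⇒memberᵇ-false n3 = refl
Tunnel⇒isTunnelᵇ D (i , j) (inj₂ (m2 , m3 , n1 , n4)) rewrite ∈⇒memberᵇ m2 | ∈⇒memberᵇ m3 | ∉⇒memberᵇ-false n1 | ∉⇒memberᵇ-false n4 = refl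

isTunnelᵇ⇒Tunnel : ∀ D g → isTunnelᵇ D g ≡ true → Tunnel D g
isTunnelᵇ⇒Tunnel D (i , j) p with memberᵇ D (i , j) in e1 | memberᵇ D (i + 1ℤ , j) in e2 | memberᵇ D (i , j + 1ℤ) in e3 | memberᵇ D (i + 1ℤ , j + 1ℤ) in e4
... | true | false | false | true = inj₁ (memberᵇ⇒∈ e1 , memberᵇ⇒∈ e4 , memberᵇ-false⇒∉ e2 , memberᵇ-false⇒∉ e3)
... | false | true | true | false = inj₂ (memberᵇ⇒∈ e2 , memberᵇ⇒∈ e3 , memberᵇ-false⇒∉ e1 , memberᵇ-false⇒∉ e4)
isTunnelᵇ⇒Tunnel D (i , j) () | true | true | true | true
isTunnelᵇ⇒Tunnel D (i , j) () | true | true | true | false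
isTunnelᵇ⇒Tunnel D (i , j) () | true | true | false | true
isTunnelᵇ⇒Tunnel D (i , j) () | true | true | false | false
isTunnelᵇ⇒Tunnel D (i , j) () | true | false | true | true
isTunnelᵇ⇒Tunnel D (i , j) () | true | false | true | false
isTunnelᵇ⇒Tunnel D (i , j) () | true | false | false | false
isTunnelᵇ⇒Tunnel D (i , j) () | false | true | true | true
isTunnelᵇ⇒Tunnel D (i , j) () | false | true | false | true
isTunnelᵇ⇒Tunnel D (i , j) () | false | true | false | false
isTunnelᵇ⇒Tunnel D (i , j) () | false | false | true | true
isTunnelᵇ⇒Tunnel D (i , j) () | false | false | true | false
isTunnelᵇ⇒Tunnel D (i , j) () | false | false | false | true
isTunnelᵇ⇒Tunnel D (i , j) () | false | false | false | false

module Support (M : ℕ) (D : Obj) (bnd : Bounded M D) where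
  IsVertex⇒∈gridBox : ∀ g → IsVertex D g → g ∈ gridBox M
  IsVertex⇒∈gridBox (i , j) ((a' , b') , m , inj₁ refl , inj₁ refl) with bnd _ m
  ... | u , v = ∈gridBox M _ (true∧true (InR⇒inGridRange M i u) (InR⇒inGridRange M j v))
  IsVertex⇒∈gridBox (i , j) ((a' , b') , m , inj₂ refl , inj₁ refl) with bnd _ m
  ... | u , v = ∈gridBox M _ (true∧true (InR+1⇒inGridRange M i u) (InR⇒inGridRange M j v))
  IsVertex⇒∈gridBox (i , j) ((a' , b') , m , inj₁ refl , inj₂ refl) with bnd _ m
  ... | u , v = ∈gridBox M _ (true∧true (InR⇒inGridRange M i u) (InR+1⇒inGridRange M j v))
  IsVertex⇒∈gridBox (i , j) ((a' , b') , m , inj₂ refl , inj₂ refl) with bnd _ m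
  ... | u , v = ∈gridBox M _ (true∧true (InR+1⇒inGridRange M i u) (InR+1⇒inGridRange M j v))

  isVertexᵇ⇒∈gridBox : ∀ g → isVertexᵇ D g ≡ true → g ∈ gridBox M
  isVertexᵇ⇒∈gridBox g p = IsVertex⇒∈gridBox g (isVertexᵇ⇒IsVertex D g p)

  isBlockᵇ⇒∈gridBox : ∀ g → isBlockᵇ D g ≡ true → g ∈ gridBox M
  isBlockᵇ⇒∈gridBox (i , j) p with isBlockᵇ⇒Block D (i , j) p
  ... | m1 , _ = IsVertex⇒∈gridBox (i , j) ((i , j) , m1 , inj₁ refl , inj₁ refl)

  isTunnelᵇ⇒∈gridBox : ∀ g → isTunnelᵇ D g ≡ true → g ∈ gridBox M
  isTunnelᵇ⇒∈gridBox (i , j) p with isTunnelᵇ⇒Tunnel D (i , j) p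
  ... | inj₁ (m1 , _) = IsVertex⇒∈gridBox (i , j) ((i , j) , m1 , inj₁ refl , inj₁ refl)
  ... | inj₂ (m2 , _) = IsVertex⇒∈gridBox (i , j) ((i + 1ℤ , j) , m2 , inj₂ refl , inj₁ refl)

-- H i j is the edge between the pixels (i , j) and (i , j + 1), V i j the edge between (i , j)
-- and (i + 1 , j); its endpoints end₁, end₂ use the grid-point encoding of Defs.
data Edge : Set where
  H : ℤ → ℤ → Edge
  V : ℤ → ℤ → Edge

pix₁ : Edge → Pixel
pix₁ (H i j) = (i , j)
pix₁ (V i j) = (i , j)

pix₂ : Edge → Pixel
pix₂ (H i j) = (i , j + 1ℤ)
pix₂ (V i j) = (i + 1ℤ , j)

end₁ : Edge → GridPoint
end₁ (H i j) = (i - 1ℤ , j)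
end₁ (V i j) = (i , j - 1ℤ)

end₂ : Edge → GridPoint
end₂ (H i j) = (i , j)
end₂ (V i j) = (i , j)

sameEdge : Edge → Edge → Bool
sameEdge (H i j) (H i' j') = b≡ i i' ∧ b≡ j j'
sameEdge (V i j) (V i' j') = b≡ i i' ∧ b≡ j j'
sameEdge (H _ _) (V _ _) = false
sameEdge (V _ _) (H _ _) = false

sameEdge⇒≡ : ∀ e f → sameEdge e f ≡ true → e ≡ f
sameEdge⇒≡ (H i j) (H i' j') p with ∧≡true⇒ {b≡ i i'} p
... | p1 , p2 rewrite b≡⇒≡ {i} p1 | b≡⇒≡ {j} p2 = refl
sameEdge⇒≡ (V i j) (V i' j') p with ∧≡true⇒ {b≡ i i'} p
... | p1 , p2 rewrite b≡⇒≡ {i} p1 | b≡⇒≡ {j} p2 = refl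

sameEdge-refl : ∀ e → sameEdge e e ≡ true
sameEdge-refl (H i j) rewrite b≡-refl i | b≡-refl j = refl
sameEdge-refl (V i j) rewrite b≡-refl i | b≡-refl j = refl

Joins : Edge → GridPoint → GridPoint → Set
Joins e g h = (end₁ e ≡ g × end₂ e ≡ h) ⊎ (end₂ e ≡ g × end₁ e ≡ h)

data Walk (G : Edge → Set) : GridPoint → GridPoint → Set where
  wnil : ∀ {g} → Walk G g g
  wcons : ∀ {g h k} (e : Edge) → G e → Joins e g h → Walk G h k → Walk G g k

walk-++ : ∀ {G g h k} → Walk G g h → Walk G h k → Walk G g k
walk-++ wnil w = w
walk-++ (wcons e p q w) w' = wcons e p q (walk-++ w w')

walk-map : ∀ {G G' g h} → (∀ e → G e → G' e) → Walk G g h → Walk G' g h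
walk-map f wnil = wnil
walk-map f (wcons e p q w) = wcons e (f e p) q (walk-map f w)

parityAlong : ∀ {G g h} → (Edge → Bool) → Walk G g h → Bool
parityAlong f wnil = false
parityAlong f (wcons e _ _ w) = f e xor parityAlong f w

crossesRay : Pixel → Edge → Bool
crossesRay (a , b) (V i j) = b≡ j b ∧ b≤ a i
crossesRay _ (H _ _) = false

onRay : Pixel → GridPoint → Bool
onRay (a , b) (i , j) = b≡ j b ∧ b≤ a i

rayParity : ∀ {G g h} → Walk G g h → Pixel → Bool
rayParity w P = parityAlong (crossesRay P) w

edgeParity : ∀ {G g h} → Walk G g h → Edge → Bool
edgeParity w f = parityAlong (λ e → sameEdge e f) w

crossesRay-up : ∀ a b e → (crossesRay (a , b) e xor crossesRay (a , b + 1ℤ) e) xor sameEdge e (H a b)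
              ≡ onRay (a , b) (end₁ e) xor onRay (a , b) (end₂ e)
crossesRay-up a b (H i j) rewrite sym (b≤-pred-xor a i) with b≡ j b | b≤ a (i - 1ℤ) | b≤ a i
... | true | true | true = refl
... | true | true | false = refl
... | true | false | true = refl
... | true | false | false = refl
... | false | true | true = refl
... | false | true | false = refl
... | false | false | true = refl
... | false | false | false = refl
crossesRay-up a b (V i j) rewrite b≡-+1ʳ j b with b≡ j b | b≡ (j - 1ℤ) b | b≤ a i
... | true | true | true = refl
... | true | false | true = refl
... | false | true | true = refl
... | false | false | true = refl
... | true | true | false = refl
... | true | false | false = refl
... | false | true | false = refl
... | false | false | false = refl

crossesRay-right : ∀ a b e → crossesRay (a , b) e xor crossesRay (a + 1ℤ , b) e ≡ sameEdge e (V a b)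
crossesRay-right a b (H i j) = refl
crossesRay-right a b (V i j) rewrite sym (b≤-suc-xor a i) with b≡ j b | b≤ a i | b≤ (a + 1ℤ) i
... | true | true | true = refl
... | true | true | false = refl
... | true | false | true = refl
... | true | false | false = refl
... | false | true | true = refl
... | false | true | false = refl
... | false | false | true = refl
... | false | false | false = refl

xor-interchange : ∀ p q r s → (p xor q) xor (r xor s) ≡ (p xor r) xor (q xor s)
xor-interchange = solve 4 (λ p q r s → (p ⊕ q) ⊕ (r ⊕ s) := (p ⊕ r) ⊕ (q ⊕ s)) refl

xor-telescope : ∀ p q r → (p xor q) xor (q xor r) ≡ p xor r
xor-telescope = solve 3 (λ p q r → (p ⊕ q) ⊕ (q ⊕ r) := p ⊕ r) refl

xor-telescope′ : ∀ p q r → (q xor p) xor (q xor r) ≡ p xor r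
xor-telescope′ = solve 3 (λ p q r → (q ⊕ p) ⊕ (q ⊕ r) := p ⊕ r) refl

parityAlong-xor : ∀ {G g h} (f f' : Edge → Bool) (w : Walk G g h) →
  parityAlong (λ e → f e xor f' e) w ≡ parityAlong f w xor parityAlong f' w
parityAlong-xor f f' wnil = refl
parityAlong-xor f f' (wcons e _ _ w) rewrite parityAlong-xor f f' w = xor-interchange (f e) (f' e) (parityAlong f w) (parityAlong f' w)

parityAlong-cong : ∀ {G g h} (f f' : Edge → Bool) → (∀ e → f e ≡ f' e) → (w : Walk G g h) →
  parityAlong f w ≡ parityAlong f' w
parityAlong-cong f f' p wnil = refl
parityAlong-cong f f' p (wcons e _ _ w) rewrite p e | parityAlong-cong f f' p w = refl

parityAlong-false : ∀ {G g h} (f : Edge → Bool) → (∀ e → G e → f e ≡ false) → (w : Walk G g h) →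
  parityAlong f w ≡ false
parityAlong-false f p wnil = refl
parityAlong-false f p (wcons e ge _ w) rewrite p e ge | parityAlong-false f p w = refl

parityAlong-telescope : ∀ P {G g h} (w : Walk G g h) →
  parityAlong (λ e → onRay P (end₁ e) xor onRay P (end₂ e)) w ≡ onRay P g xor onRay P h
parityAlong-telescope P {g = g} wnil = sym (xor-same (onRay P g))
parityAlong-telescope P {g = g} {h = k} (wcons e _ (inj₁ (refl , refl)) w) rewrite parityAlong-telescope P w =
  xor-telescope (onRay P (end₁ e)) (onRay P (end₂ e)) (onRay P k)
parityAlong-telescope P {g = g} {h = k} (wcons e _ (inj₂ (refl , refl)) w) rewrite parityAlong-telescope P w =
  xor-telescope′ (onRay P (end₂ e)) (onRay P (end₁ e)) (onRay P k)

rayParity-up : ∀ {G g} (w : Walk G g g) a b →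
  (rayParity w (a , b) xor rayParity w (a , b + 1ℤ)) xor edgeParity w (H a b) ≡ false
rayParity-up {g = g} w a b =
  trans (cong (_xor edgeParity w (H a b)) (sym (parityAlong-xor (crossesRay (a , b)) (crossesRay (a , b + 1ℤ)) w)))
  (trans (sym (parityAlong-xor (λ e → crossesRay (a , b) e xor crossesRay (a , b + 1ℤ) e) (λ e → sameEdge e (H a b)) w))
  (trans (parityAlong-cong _ _ (crossesRay-up a b) w) (trans (parityAlong-telescope (a , b) w) (xor-same (onRay (a , b) g)))))

rayParity-right : ∀ {G g h} (w : Walk G g h) a b →
  rayParity w (a , b) xor rayParity w (a + 1ℤ , b) ≡ edgeParity w (V a b)
rayParity-right w a b = trans (sym (parityAlong-xor (crossesRay (a , b)) (crossesRay (a + 1ℤ , b)) w)) (parityAlong-cong _ _ (crossesRay-right a b) w)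

data Corner : Set where
  k00 k10 k01 k11 : Corner

corner : ℤ → ℤ → Corner → GridPoint
corner i j k00 = (i , j)
corner i j k10 = (i + 1ℤ , j)
corner i j k01 = (i , j + 1ℤ)
corner i j k11 = (i + 1ℤ , j + 1ℤ)

SideOf : Pixel → Edge → Set
SideOf Q e = pix₁ e ≡ Q ⊎ pix₂ e ≡ Q

module PixelBoundary (i j : ℤ) where
  Q : Pixel
  Q = (i + 1ℤ , j + 1ℤ)
  eb et el er : Edge
  eb = H (i + 1ℤ) j
  et = H (i + 1ℤ) (j + 1ℤ)
  el = V i (j + 1ℤ)
  er = V (i + 1ℤ) (j + 1ℤ)
  Wq : GridPoint → GridPoint → Set
  Wq = Walk (SideOf Q)
  ebA : end₁ eb ≡ corner i j k00
  ebA = cong (_, j) (i+1-1≡i i)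
  etA : end₁ et ≡ corner i j k01
  etA = cong (_, j + 1ℤ) (i+1-1≡i i)
  elA : end₁ el ≡ corner i j k00
  elA = cong (i ,_) (i+1-1≡i j)
  erA : end₁ er ≡ corner i j k10
  erA = cong (i + 1ℤ ,_) (i+1-1≡i j)
  b+ : Wq (corner i j k00) (corner i j k10)
  b+ = wcons eb (inj₂ refl) (inj₁ (ebA , refl)) wnil
  b- : Wq (corner i j k10) (corner i j k00)
  b- = wcons eb (inj₂ refl) (inj₂ (refl , ebA)) wnil
  t+ : Wq (corner i j k01) (corner i j k11)
  t+ = wcons et (inj₁ refl) (inj₁ (etA , refl)) wnil
  t- : Wq (corner i j k11) (corner i j k01)
  t- = wcons et (inj₁ refl) (inj₂ (refl , etA)) wnil
  l+ : Wq (corner i j k00) (corner i j k01)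
  l+ = wcons el (inj₂ refl) (inj₁ (elA , refl)) wnil
  l- : Wq (corner i j k01) (corner i j k00)
  l- = wcons el (inj₂ refl) (inj₂ (refl , elA)) wnil
  r+ : Wq (corner i j k10) (corner i j k11)
  r+ = wcons er (inj₁ refl) (inj₁ (erA , refl)) wnil
  r- : Wq (corner i j k11) (corner i j k10)
  r- = wcons er (inj₁ refl) (inj₂ (refl , erA)) wnil
  around : ∀ k k' → Wq (corner i j k) (corner i j k')
  around k00 k00 = wnil
  around k00 k10 = b+
  around k00 k01 = l+
  around k00 k11 = walk-++ b+ r+
  around k10 k00 = b-
  around k10 k10 = wnil
  around k10 k01 = walk-++ r+ t-
  around k10 k11 = r+
  around k01 k00 = l-
  around k01 k10 = walk-++ t+ r-
  around k01 k01 = wnil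
  around k01 k11 = t+
  around k11 k00 = walk-++ r- b-
  around k11 k10 = r-
  around k11 k01 = t-
  around k11 k11 = wnil

data Bit : Set where
  blo bhi : Bit

bitShift : ℤ → Bit → ℤ
bitShift i blo = i
bitShift i bhi = i + 1ℤ

vertexCoordinate : ∀ {a i} → (a ≡ i) ⊎ (a ≡ i + 1ℤ) → Σ ℤ λ i0 → a ≡ i0 + 1ℤ × Σ Bit λ t → i ≡ bitShift i0 t
vertexCoordinate {a} {i} (inj₁ refl) = (a - 1ℤ) , sym (i-1+1≡i a) , bhi , sym (i-1+1≡i a)
vertexCoordinate {a} {i} (inj₂ refl) = i , refl , blo , refl

mkCorner : Bit → Bit → Corner
mkCorner blo blo = k00
mkCorner bhi blo = k10
mkCorner blo bhi = k01
mkCorner bhi bhi = k11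

corner-mkCorner : ∀ i j s t → corner i j (mkCorner s t) ≡ (bitShift i s , bitShift j t)
corner-mkCorner i j blo blo = refl
corner-mkCorner i j bhi blo = refl
corner-mkCorner i j blo bhi = refl
corner-mkCorner i j bhi bhi = refl

+1-injective : ∀ {i i'} → i + 1ℤ ≡ i' + 1ℤ → i ≡ i'
+1-injective {i} {i'} p = trans (sym (i+1-1≡i i)) (trans (cong (_- 1ℤ) p) (i+1-1≡i i'))

walkAround : ∀ Q g g' → HasVertex Q g → HasVertex Q g' → Walk (SideOf Q) g g'
walkAround (a , b) (i , j) (i' , j') (va , vb) (va' , vb') with vertexCoordinate va | vertexCoordinate vb | vertexCoordinate va' | vertexCoordinate vb'
... | i0 , refl , s , refl | j0 , refl , t , refl | i1 , e1 , s' , refl | j1 , e2 , t' , refl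
  with +1-injective {i0} {i1} e1 | +1-injective {j0} {j1} e2
... | refl | refl =
  subst₂ (Walk (SideOf (i0 + 1ℤ , j0 + 1ℤ))) (corner-mkCorner i0 j0 s t) (corner-mkCorner i0 j0 s' t')
    (PixelBoundary.around i0 j0 (mkCorner s t) (mkCorner s' t'))

j-i≡-[i-j] : ∀ a a' → a' - a ≡ - (a - a')
j-i≡-[i-j] = ZS.solve 2 (λ a a' → a' ZS.:- a ZS.:= ZS.:- (a ZS.:- a')) refl

j≡i-[i-j] : ∀ a a' → a' ≡ a - (a - a')
j≡i-[i-j] = ZS.solve 2 (λ a a' → a' ZS.:= a ZS.:- (a ZS.:- a')) refl

∣i-j∣≤1⇒commonInterval : ∀ a a' → ∣ a - a' ∣ ℕ.≤ 1 → Σ ℤ λ i → ((a ≡ i) ⊎ (a ≡ i + 1ℤ)) × ((a' ≡ i) ⊎ (a' ≡ i + 1ℤ))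
∣i-j∣≤1⇒commonInterval a a' p with ∣i∣≤1-cases (a - a') p
... | inj₁ q = a , inj₁ refl , inj₂ (trans (j≡i-[i-j] a a') (cong (λ z → a - z) q))
... | inj₂ (inj₁ q) = a , inj₁ refl , inj₁ (sym (trans (i-j≡k⇒i≡j+k a a' (+ 0) q) (ZP.+-identityʳ a')))
... | inj₂ (inj₂ q) = a' , inj₂ (i-j≡k⇒i≡j+k a a' 1ℤ q) , inj₁ refl

Adj0⇒commonVertex : ∀ P Q → Adj0 P Q → Σ GridPoint λ g → HasVertex P g × HasVertex Q g
Adj0⇒commonVertex (a , b) (a' , b') (p , q) with ∣i-j∣≤1⇒commonInterval a a' p | ∣i-j∣≤1⇒commonInterval b b' q
... | i , u , u' | j , v , v' = (i , j) , (u , v) , (u' , v')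

commonInterval⇒∣i-j∣≤1 : ∀ {a a' i} → (a ≡ i) ⊎ (a ≡ i + 1ℤ) → (a' ≡ i) ⊎ (a' ≡ i + 1ℤ) → ∣ a - a' ∣ ℕ.≤ 1
commonInterval⇒∣i-j∣≤1 {i = i} (inj₁ refl) (inj₁ refl) rewrite ZP.+-inverseʳ i = z≤n
commonInterval⇒∣i-j∣≤1 {i = i} (inj₂ refl) (inj₂ refl) rewrite ZP.+-inverseʳ (i + 1ℤ) = z≤n
commonInterval⇒∣i-j∣≤1 {i = i} (inj₁ refl) (inj₂ refl) rewrite i-[i+j]≡-j i 1ℤ = s≤s z≤n
commonInterval⇒∣i-j∣≤1 {i = i} (inj₂ refl) (inj₁ refl) rewrite [i+j]-i≡j i 1ℤ = s≤s z≤n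

commonVertex⇒Adj0 : ∀ P Q g → HasVertex P g → HasVertex Q g → Adj0 P Q
commonVertex⇒Adj0 (a , b) (a' , b') (i , j) (u , v) (u' , v') = commonInterval⇒∣i-j∣≤1 u u' , commonInterval⇒∣i-j∣≤1 v v'

Touches : (Pixel → Set) → Edge → Set
Touches S e = S (pix₁ e) ⊎ S (pix₂ e)

SideOf⇒Touches : ∀ (S : Pixel → Set) Q → S Q → ∀ e → SideOf Q e → Touches S e
SideOf⇒Touches S Q sq e (inj₁ p) = inj₁ (subst S (sym p) sq)
SideOf⇒Touches S Q sq e (inj₂ p) = inj₂ (subst S (sym p) sq)

Conn0⇒walk : ∀ (S : Pixel → Set) P Q g g' → S P → Conn S Adj0 P Q → HasVertex P g → HasVertex Q g' →
  Walk (Touches S) g g'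
Conn0⇒walk S P .P g g' sp ε hp hq = walk-map (SideOf⇒Touches S P sp) (walkAround P g g' hp hq)
Conn0⇒walk S P Q g g' sp ((_ , s1 , adj) ◅ rest) hp hq with Adj0⇒commonVertex P _ adj
... | c , hpc , h1c = walk-++ (walk-map (SideOf⇒Touches S P sp) (walkAround P g c hp hpc)) (Conn0⇒walk S _ Q c g' s1 rest h1c hq)

parityAlong-++ : ∀ {G g h k} (f : Edge → Bool) (w : Walk G g h) (w' : Walk G h k) →
  parityAlong f (walk-++ w w') ≡ parityAlong f w xor parityAlong f w'
parityAlong-++ f wnil w' = refl
parityAlong-++ f (wcons e _ _ w) w' rewrite parityAlong-++ f w w' = sym (xor-assoc (f e) (parityAlong f w) (parityAlong f w'))

≢⇒sameEdge-false : ∀ e f → ¬ e ≡ f → sameEdge e f ≡ false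
≢⇒sameEdge-false e f ne with sameEdge e f in eq
... | true = ⊥-elim (ne (sameEdge⇒≡ e f eq))
... | false = refl

edgeParity-untouched : ∀ {T : Pixel → Set} {g h} (W : Walk (Touches T) g h) f → ¬ T (pix₁ f) → ¬ T (pix₂ f) →
  edgeParity W f ≡ false
edgeParity-untouched {T} W f na nb = parityAlong-false (λ e → sameEdge e f) gf W
  where
  gf : ∀ e → Touches T e → sameEdge e f ≡ false
  gf e (inj₁ t) = ≢⇒sameEdge-false e f λ { refl → na t }
  gf e (inj₂ t) = ≢⇒sameEdge-false e f λ { refl → nb t }

xor≡false⇒≡ : ∀ p q → p xor q ≡ false → p ≡ q
xor≡false⇒≡ true true _ = refl
xor≡false⇒≡ false false _ = refl

rayParity-up-untouched : ∀ {G g} (w : Walk G g g) a b → edgeParity w (H a b) ≡ false → rayParity w (a , b) ≡ rayParity w (a , b + 1ℤ)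
rayParity-up-untouched w a b c = xor≡false⇒≡ _ _ (trans (sym (xor-identityʳ _)) (trans (cong ((rayParity w (a , b) xor rayParity w (a , b + 1ℤ)) xor_) (sym c)) (rayParity-up w a b)))

rayParity-Adj1 : ∀ {T : Pixel → Set} {g} (W : Walk (Touches T) g g) P P' → ¬ T P → ¬ T P' → Adj1 P P' →
  rayParity W P ≡ rayParity W P'
rayParity-Adj1 {T} W (p1 , p2) (q1 , q2) nP nP' adj with ∣i∣+∣j∣≡1-cases (p1 - q1) (p2 - q2) adj
... | inj₁ (inj₁ d1 , d2) with i-j≡k⇒i≡j+k q1 p1 1ℤ (trans (j-i≡-[i-j] p1 q1) (cong -_ d1)) | i-j≡k⇒i≡j+k p2 q2 (+ 0) d2
...   | refl | refl rewrite ZP.+-identityʳ q2 =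
  xor≡false⇒≡ _ _ (trans (rayParity-right W p1 q2) (edgeParity-untouched W (V p1 q2) nP nP'))
rayParity-Adj1 {T} W (p1 , p2) (q1 , q2) nP nP' adj | inj₁ (inj₂ d1 , d2) with i-j≡k⇒i≡j+k p1 q1 1ℤ d1 | i-j≡k⇒i≡j+k p2 q2 (+ 0) d2
...   | refl | refl rewrite ZP.+-identityʳ q2 =
  sym (xor≡false⇒≡ _ _ (trans (rayParity-right W q1 q2) (edgeParity-untouched W (V q1 q2) nP' nP)))
rayParity-Adj1 {T} W (p1 , p2) (q1 , q2) nP nP' adj | inj₂ (d1 , inj₁ d2) with i-j≡k⇒i≡j+k p1 q1 (+ 0) d1 | i-j≡k⇒i≡j+k q2 p2 1ℤ (trans (j-i≡-[i-j] p2 q2) (cong -_ d2))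
...   | refl | refl rewrite ZP.+-identityʳ q1 =
  rayParity-up-untouched W q1 p2 (edgeParity-untouched W (H q1 p2) nP nP')
rayParity-Adj1 {T} W (p1 , p2) (q1 , q2) nP nP' adj | inj₂ (d1 , inj₂ d2) with i-j≡k⇒i≡j+k p1 q1 (+ 0) d1 | i-j≡k⇒i≡j+k p2 q2 1ℤ d2
...   | refl | refl rewrite ZP.+-identityʳ q1 =
  sym (rayParity-up-untouched W q1 q2 (edgeParity-untouched W (H q1 q2) nP' nP))

rayParity-Conn1 : ∀ {T : Pixel → Set} {g} (W : Walk (Touches T) g g) P P' → Conn (λ y → ¬ T y) Adj1 P P' →
  rayParity W P ≡ rayParity W P'
rayParity-Conn1 W P .P ε = refl
rayParity-Conn1 W P P' ((nP , nP1 , adj) ◅ rest) = trans (rayParity-Adj1 W P _ nP nP1 adj) (rayParity-Conn1 W _ P' rest)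

parityAlong-map : ∀ {G G' : Edge → Set} {g h} (f : Edge → Bool) (k : ∀ e → G e → G' e) (w : Walk G g h) →
  parityAlong f (walk-map k w) ≡ parityAlong f w
parityAlong-map f k wnil = refl
parityAlong-map {G} {G'} f k (wcons e _ _ w) = cong (f e xor_) (parityAlong-map {G} {G'} f k w)

rayParity-up-crossed : ∀ {G g} (w : Walk G g g) a b → edgeParity w (H a b) ≡ true →
  rayParity w (a , b) ≢ rayParity w (a , b + 1ℤ)
rayParity-up-crossed w a b crossed same = true≢false (trans (sym true≡) (rayParity-up w a b))
  where
  true≢false : true ≢ false
  true≢false ()
  q : Bool
  q = rayParity w (a , b + 1ℤ)
  true≡ : (rayParity w (a , b) xor q) xor edgeParity w (H a b) ≡ true
  true≡ = trans (cong₂ (λ p e → (p xor q) xor e) same crossed) (cong (_xor true) (xor-same q))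

-- The S-walk from a corner of N to a corner of BR, closed by the edge between x = (a , b) and
-- the pixel below, crosses that edge once and avoids the edge above x: the pixels below and
-- above x get different ray parities, which a 1-path avoiding T cannot change.
loop-separates : ∀ (S T : Pixel → Set) a b N BR →
  (∀ y → S y → T y) → T (a , b) → ¬ S (a , b) → ¬ T (a , b - 1ℤ) → ¬ S (a , b + 1ℤ) →
  S N → HasVertex N (a - 1ℤ , b - 1ℤ) → HasVertex BR (a , b - 1ℤ) → Conn S Adj0 N BR →
  ¬ Conn (λ y → ¬ T y) Adj1 (a , b - 1ℤ) (a , b + 1ℤ)
loop-separates S T a b N BR S⊆T Tx ¬Sx ¬TB ¬SU SN vN vBR N~BR path =
  B≢x (trans (rayParity-Conn1 loop _ _ path) (sym x≡U))
  where
  e0 : Edge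
  e0 = H a (b - 1ℤ)
  row : ∀ {P : Pixel → Set} → P (a , b) → P (a , (b - 1ℤ) + 1ℤ)
  row {P} = subst (λ z → P (a , z)) (sym (i-1+1≡i b))
  W' : Walk (Touches S) (a - 1ℤ , b - 1ℤ) (a , b - 1ℤ)
  W' = Conn0⇒walk S N BR _ _ SN N~BR vN vBR
  weaken : ∀ e → Touches S e → Touches T e
  weaken _ = Sum.map (S⊆T _) (S⊆T _)
  loop : Walk (Touches T) (a - 1ℤ , b - 1ℤ) (a - 1ℤ , b - 1ℤ)
  loop = walk-++ (walk-map weaken W') (wcons e0 (inj₂ (row {T} Tx)) (inj₂ (refl , refl)) wnil)
  edgeParity-loop : ∀ f → edgeParity loop f ≡ edgeParity W' f xor (sameEdge e0 f xor false)
  edgeParity-loop f = trans (parityAlong-++ _ (walk-map weaken W') _) (cong (_xor _) (parityAlong-map (λ e → sameEdge e f) weaken W'))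
  crosses-e0 : edgeParity loop e0 ≡ true
  crosses-e0 = trans (edgeParity-loop e0) (cong₂ (λ p q → p xor (q xor false)) W'-misses-e0 (sameEdge-refl e0))
    where
    W'-misses-e0 : edgeParity W' e0 ≡ false
    W'-misses-e0 = edgeParity-untouched {S} W' e0 (λ s → ¬TB (S⊆T _ s)) (row {λ y → ¬ S y} ¬Sx)
  e0≢above : sameEdge e0 (H a b) ≡ false
  e0≢above rewrite b≡-refl a | ≢⇒b≡-false (i-1≢i b) = refl
  misses-above : edgeParity loop (H a b) ≡ false
  misses-above = trans (edgeParity-loop (H a b))
    (cong₂ (λ p q → p xor (q xor false)) (edgeParity-untouched {S} W' (H a b) ¬Sx ¬SU) e0≢above)
  B≢x : rayParity loop (a , b - 1ℤ) ≢ rayParity loop (a , b)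
  B≢x = subst (λ z → rayParity loop (a , b - 1ℤ) ≢ rayParity loop (a , z)) (i-1+1≡i b)
    (rayParity-up-crossed loop a (b - 1ℤ) crosses-e0)
  x≡U : rayParity loop (a , b) ≡ rayParity loop (a , b + 1ℤ)
  x≡U = rayParity-up-untouched loop a b misses-above

edge-inGridBox : ∀ M e → InBox M (pix₁ e) ⊎ InBox M (pix₂ e) → inGridBox M (end₁ e) ≡ true × inGridBox M (end₂ e) ≡ true
edge-inGridBox M (H i j) (inj₁ (u , v)) = true∧true (InR⇒inGridRange-1 M i u) (InR⇒inGridRange M j v) , true∧true (InR⇒inGridRange M i u) (InR⇒inGridRange M j v)
edge-inGridBox M (H i j) (inj₂ (u , v)) = true∧true (InR⇒inGridRange-1 M i u) (InR+1⇒inGridRange M j v) , true∧true (InR⇒inGridRange M i u) (InR+1⇒inGridRange M j v)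
edge-inGridBox M (V i j) (inj₁ (u , v)) = true∧true (InR⇒inGridRange M i u) (InR⇒inGridRange-1 M j v) , true∧true (InR⇒inGridRange M i u) (InR⇒inGridRange M j v)
edge-inGridBox M (V i j) (inj₂ (u , v)) = true∧true (InR+1⇒inGridRange M i u) (InR⇒inGridRange-1 M j v) , true∧true (InR+1⇒inGridRange M i u) (InR⇒inGridRange M j v)

pix₁-end₁ : ∀ e → HasVertex (pix₁ e) (end₁ e)
pix₁-end₁ (H i j) = inj₂ (sym (i-1+1≡i i)) , inj₁ refl
pix₁-end₁ (V i j) = inj₁ refl , inj₂ (sym (i-1+1≡i j))

pix₁-end₂ : ∀ e → HasVertex (pix₁ e) (end₂ e)
pix₁-end₂ (H i j) = inj₁ refl , inj₁ refl
pix₁-end₂ (V i j) = inj₁ refl , inj₁ refl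

pix₂-end₁ : ∀ e → HasVertex (pix₂ e) (end₁ e)
pix₂-end₁ (H i j) = inj₂ (sym (i-1+1≡i i)) , inj₂ refl
pix₂-end₁ (V i j) = inj₂ refl , inj₂ (sym (i-1+1≡i j))

pix₂-end₂ : ∀ e → HasVertex (pix₂ e) (end₂ e)
pix₂-end₂ (H i j) = inj₁ refl , inj₂ refl
pix₂-end₂ (V i j) = inj₂ refl , inj₁ refl

pix₁-Adj1-pix₂ : ∀ e → Adj1 (pix₁ e) (pix₂ e)
pix₁-Adj1-pix₂ (H i j) = Adj1-up i j
pix₁-Adj1-pix₂ (V i j) = Adj1-right i j

xorSum : ℕ → (ℕ → Bool) → Bool
xorSum zero f = false
xorSum (suc n) f = xorSum n f xor f n

xorSum-xor : ∀ n f g → xorSum n (λ k → f k xor g k) ≡ xorSum n f xor xorSum n g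
xorSum-xor zero f g = refl
xorSum-xor (suc n) f g rewrite xorSum-xor n f g = xor-interchange (xorSum n f) (xorSum n g) (f n) (g n)

xorSum-cong : ∀ n f g → (∀ k → f k ≡ g k) → xorSum n f ≡ xorSum n g
xorSum-cong zero f g p = refl
xorSum-cong (suc n) f g p rewrite xorSum-cong n f g p | p n = refl

xorSum-false : ∀ n f → (∀ k → f k ≡ false) → xorSum n f ≡ false
xorSum-false zero f p = refl
xorSum-false (suc n) f p rewrite xorSum-false n f p | p n = refl

xorSum-shift : ∀ n f → xorSum n (λ k → f (suc k)) ≡ (xorSum n f xor f 0) xor f n
xorSum-shift zero f = sym (xor-same (f 0))
xorSum-shift (suc n) f rewrite xorSum-shift n f = rotate (xorSum n f) (f 0) (f n) (f (suc n))
  where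
  rotate : ∀ p q r s → ((p xor q) xor r) xor s ≡ ((p xor r) xor q) xor s
  rotate = solve 4 (λ p q r s → ((p ⊕ q) ⊕ r) ⊕ s := ((p ⊕ r) ⊕ q) ⊕ s) refl

xorSum-∧ : ∀ n p f → xorSum n (λ k → p ∧ f k) ≡ p ∧ xorSum n f
xorSum-∧ zero p f = sym (∧-zeroʳ p)
xorSum-∧ (suc n) p f rewrite xorSum-∧ n p f = sym (∧-distribˡ-xor p (xorSum n f) (f n))

xorSum-false< : ∀ n f → (∀ k → k ℕ.< n → f k ≡ false) → xorSum n f ≡ false
xorSum-false< zero f p = refl
xorSum-false< (suc n) f p rewrite xorSum-false< n f (λ k lt → p k (NP.m<n⇒m<1+n lt)) | p n NP.≤-refl = refl

xorSum-indicator : ∀ n n0 → n0 ℕ.< n → xorSum n (λ k → ⌊ k ℕ.≟ n0 ⌋) ≡ true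
xorSum-indicator (suc n) n0 lt with n0 ℕ.≟ n
... | yes refl rewrite xorSum-false< n (λ k → ⌊ k ℕ.≟ n0 ⌋) (λ k klt → nb≢ k n0 (λ e → NP.<-irrefl e klt))
                     | nb≡-refl n0 = refl
... | no ne rewrite xorSum-indicator n n0 (NP.≤∧≢⇒< (NP.≤-pred lt) ne) | nb≢ n n0 (λ e → ne (sym e)) = refl

degree-parity : ∀ p q r s u v → ((p xor q) xor u) xor (((r xor s) xor v) xor (((p xor r) xor false) xor ((q xor s) xor false))) ≡ u xor v
degree-parity = solve 6 (λ p q r s u v → ((p ⊕ q) ⊕ u) ⊕ (((r ⊕ s) ⊕ v) ⊕ (((p ⊕ r) ⊕ con false) ⊕ ((q ⊕ s) ⊕ con false))) := u ⊕ v) refl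

xorSum² : ℕ → (ℕ → ℕ → Bool) → Bool
xorSum² W f = xorSum W (λ n → xorSum W (λ m → f n m))

xorSum²-xor : ∀ W f g → xorSum² W (λ n m → f n m xor g n m) ≡ xorSum² W f xor xorSum² W g
xorSum²-xor W f g = trans (xorSum-cong W _ _ (λ n → xorSum-xor W (f n) (g n))) (xorSum-xor W _ _)

gridIndex-injective : ∀ (n n0 K : ℕ) → + n - + K ≡ + n0 - + K → n ≡ n0
gridIndex-injective n n0 K p = ZP.+-injective (trans (sym (i-j+j≡i (+ n) (+ K))) (trans (cong (_+ + K) p) (i-j+j≡i (+ n0) (+ K))))

b≡-gridIndex : ∀ (n n0 K : ℕ) → b≡ (+ n - + K) (+ n0 - + K) ≡ ⌊ n ℕ.≟ n0 ⌋
b≡-gridIndex n n0 K with n ℕ.≟ n0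
... | yes refl = b≡-refl _
... | no ne = ≢⇒b≡-false (λ e → ne (gridIndex-injective n n0 K e))

gridIndex-suc : ∀ (n K : ℕ) → + suc n - + K ≡ (+ n - + K) + 1ℤ
gridIndex-suc n K = ZS.solve 2 (λ a k → (ZS.con 1ℤ ZS.:+ a) ZS.:- k ZS.:= (a ZS.:- k) ZS.:+ ZS.con 1ℤ) refl (+ n) (+ K)

-- γ is a set of grid points closed along the boundary edges of κ other than the cut. Summing the
-- degrees over γ counts each such edge twice, while only the two ends of the cut have odd
-- degree; so both ends lie in γ or neither does.
module Handshake (M : ℕ) (κ : Pixel → Bool) (γ : GridPoint → Bool) (c d : ℤ) where

  K : ℕ
  K = suc (suc M)

  width : ℕ
  width = K ℕ.+ K

  gridPoint : ℕ → ℕ → GridPoint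
  gridPoint n m = (+ n - + K , + m - + K)

  column : (GridPoint → Bool) → ℕ → Bool
  column f n = xorSum width (λ m → f (gridPoint n m))

  Σ² : (GridPoint → Bool) → Bool
  Σ² f = xorSum width (column f)

  Σ²-cong : ∀ {f f'} → (∀ g → f g ≡ f' g) → Σ² f ≡ Σ² f'
  Σ²-cong eq = xorSum-cong width _ _ (λ n → xorSum-cong width _ _ (λ m → eq (gridPoint n m)))

  Σ²-xor : ∀ f f' → Σ² (λ g → f g xor f' g) ≡ Σ² f xor Σ² f'
  Σ²-xor f f' = xorSum²-xor width (λ n m → f (gridPoint n m)) (λ n m → f' (gridPoint n m))

  separates : Edge → Bool
  separates e = κ (pix₁ e) xor κ (pix₂ e)

  cut : Edge
  cut = H c d

  onBoundary : Edge → Bool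
  onBoundary e = separates e ∧ not (sameEdge e cut)

  left right down up : GridPoint → Edge
  left (i , j) = H i j
  right (i , j) = H (i + 1ℤ) j
  down (i , j) = V i j
  up (i , j) = V i (j + 1ℤ)

  degree : GridPoint → Bool
  degree g = onBoundary (left g) xor (onBoundary (right g) xor (onBoundary (down g) xor onBoundary (up g)))

  isPoint : GridPoint → GridPoint → Bool
  isPoint (i , j) (i' , j') = b≡ i i' ∧ b≡ j j'

  index0-outside : inGridRange M (+ 0 - + K) ≡ false
  index0-outside rewrite ZP.+-identityˡ (- + K) = cong (_∧ b≤ -[1+ suc M ] (+ M)) (≰⇒b≤-false λ p → NP.<-irrefl refl (ZP.drop‿-≤- p))

  width-K≡K : + width - + K ≡ + K
  width-K≡K = trans (cong (_- + K) (sym (ZP.pos-+ K K))) ([i+j]-i≡j (+ K) (+ K))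

  indexWidth-outside : inGridRange M (+ width - + K) ≡ false
  indexWidth-outside rewrite width-K≡K | ≰⇒b≤-false {+ K} {+ M} (λ p → NP.<-irrefl refl (NP.≤-trans (s≤s (NP.n≤1+n M)) (ZP.drop‿+≤+ p))) = ∧-zeroʳ (b≤ -[1+ M ] (+ K))

  gridIndex-onto : ∀ i → inGridRange M i ≡ true → Σ ℕ λ n0 → n0 ℕ.< width × + n0 - + K ≡ i
  gridIndex-onto i p with ∧≡true⇒ {b≤ -[1+ M ] i} p
  ... | p1 , p2 = ∣ i + + K ∣ , lt , eq
    where
    lo1 : -[1+ M ] ≤ i
    lo1 = b≤⇒≤ p1
    hi1 : i ≤ + M
    hi1 = b≤⇒≤ p2
    nonneg : + 0 ≤ i + + K
    nonneg = ZP.≤-trans (ℤ.+≤+ z≤n) (subst (_≤ i + + K) (ZS.solve 1 (λ m → (ZS.:- (ZS.con 1ℤ ZS.:+ m)) ZS.:+ (ZS.con 1ℤ ZS.:+ (ZS.con 1ℤ ZS.:+ m)) ZS.:= ZS.con 1ℤ) refl (+ M)) (ZP.+-monoˡ-≤ (+ K) lo1))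
    abs-eq : + ∣ i + + K ∣ ≡ i + + K
    abs-eq = ZP.0≤i⇒+∣i∣≡i nonneg
    eq : + ∣ i + + K ∣ - + K ≡ i
    eq = trans (cong (_- + K) abs-eq) (ZS.solve 2 (λ a k → (a ZS.:+ k) ZS.:- k ZS.:= a) refl i (+ K))
    lt : ∣ i + + K ∣ ℕ.< width
    lt = ZP.drop‿+<+ (subst (ℤ._< + width) (sym abs-eq)
           (ZP.≤-<-trans (ZP.+-monoˡ-≤ (+ K) hi1) (subst (ℤ._< + width) (ZP.pos-+ M K) (ℤ.+<+ (NP.+-monoˡ-< K (NP.n≤1+n (suc M)))))))

  module _ (cut-separates : separates cut ≡ true) (γ-closed : ∀ e → onBoundary e ≡ true → γ (end₁ e) ≡ γ (end₂ e))
           (γ-inGridBox : ∀ g → γ g ≡ true → inGridBox M g ≡ true) where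

    γ-outside : ∀ g → inGridBox M g ≡ false → γ g ≡ false
    γ-outside g p with γ g in eq
    ... | true = ⊥-elim (f≢t (trans (sym p) (γ-inGridBox g eq)))
      where
      f≢t : ¬ false ≡ true
      f≢t ()
    ... | false = refl

    onBoundary≡separates-xor-cut : ∀ e → onBoundary e ≡ separates e xor sameEdge e cut
    onBoundary≡separates-xor-cut e with sameEdge e cut in eq
    ... | true with sameEdge⇒≡ e cut eq
    ...   | refl rewrite cut-separates = refl
    onBoundary≡separates-xor-cut e | false = trans (∧-identityʳ (separates e)) (sym (xor-identityʳ (separates e)))

    degree≡cutEnd : ∀ i j → degree (i , j) ≡ isPoint (i , j) (c , d) xor isPoint (i , j) (c - 1ℤ , d)
    degree≡cutEnd i j rewrite onBoundary≡separates-xor-cut (H i j) | onBoundary≡separates-xor-cut (H (i + 1ℤ) j)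
                            | onBoundary≡separates-xor-cut (V i j) | onBoundary≡separates-xor-cut (V i (j + 1ℤ)) | b≡-+1ˡ i c =
      degree-parity (κ (i , j)) (κ (i , j + 1ℤ)) (κ (i + 1ℤ , j)) (κ (i + 1ℤ , j + 1ℤ)) (b≡ i c ∧ b≡ j d) (b≡ i (c - 1ℤ) ∧ b≡ j d)

    isPoint-gridPoint : ∀ n m n0 m0 → isPoint (gridPoint n m) (gridPoint n0 m0) ≡ ⌊ n ℕ.≟ n0 ⌋ ∧ ⌊ m ℕ.≟ m0 ⌋
    isPoint-gridPoint n m n0 m0 rewrite b≡-gridIndex n n0 K | b≡-gridIndex m m0 K = refl

    isPoint⇒≡ : ∀ g p → isPoint g p ≡ true → g ≡ p
    isPoint⇒≡ (i , j) (i' , j') q with ∧≡true⇒ {b≡ i i'} q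
    ... | q1 , q2 rewrite b≡⇒≡ {i} q1 | b≡⇒≡ {j} q2 = refl

    Σ²-isPoint : ∀ p → Σ² (λ g → γ g ∧ isPoint g p) ≡ γ p
    Σ²-isPoint p with γ p in eqp
    ... | false = xorSum-false width _ (λ n → xorSum-false width _ (λ m → pt (gridPoint n m)))
      where
      pt : ∀ g → γ g ∧ isPoint g p ≡ false
      pt g with γ g in eqg | isPoint g p in eqb
      ... | true | true with isPoint⇒≡ g p eqb
      ...   | refl = ⊥-elim (f≢t (trans (sym eqp) eqg))
        where
        f≢t : ¬ false ≡ true
        f≢t ()
      pt g | true | false = refl
      pt g | false | _ = refl
    ... | true with γ-inGridBox p eqp
    ...   | ip with p
    ...     | (i , j) with ∧≡true⇒ {inGridRange M i} ip
    ...       | ii , ij with gridIndex-onto i ii | gridIndex-onto j ij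
    ...         | n0 , n0< , refl | m0 , m0< , refl =
      trans (xorSum-cong width _ _ (λ n → xorSum-cong width _ _ (λ m → pt n m)))
      (trans (xorSum-cong width _ _ (λ n → xorSum-∧ width ⌊ n ℕ.≟ n0 ⌋ (λ m → ⌊ m ℕ.≟ m0 ⌋)))
      (trans (xorSum-cong width _ _ (λ n → cong (⌊ n ℕ.≟ n0 ⌋ ∧_) (xorSum-indicator width m0 m0<)))
      (trans (xorSum-cong width _ _ (λ n → ∧-identityʳ ⌊ n ℕ.≟ n0 ⌋)) (xorSum-indicator width n0 n0<))))
      where
      pt : ∀ n m → γ (gridPoint n m) ∧ isPoint (gridPoint n m) (gridPoint n0 m0) ≡ ⌊ n ℕ.≟ n0 ⌋ ∧ ⌊ m ℕ.≟ m0 ⌋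
      pt n m rewrite isPoint-gridPoint n m n0 m0 with n ℕ.≟ n0 | m ℕ.≟ m0
      ... | yes refl | yes refl rewrite eqp = refl
      ... | yes _ | no _ = ∧-zeroʳ _
      ... | no _ | yes _ = ∧-zeroʳ _
      ... | no _ | no _ = ∧-zeroʳ _

    γ∧ : (GridPoint → Edge) → GridPoint → Bool
    γ∧ side g = γ g ∧ onBoundary (side g)

    γ∧degree-split : ∀ g → γ g ∧ degree g ≡ γ∧ left g xor (γ∧ right g xor (γ∧ down g xor γ∧ up g))
    γ∧degree-split g rewrite ∧-distribˡ-xor (γ g) (onBoundary (left g)) (onBoundary (right g) xor (onBoundary (down g) xor onBoundary (up g)))
                           | ∧-distribˡ-xor (γ g) (onBoundary (right g)) (onBoundary (down g) xor onBoundary (up g))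
                           | ∧-distribˡ-xor (γ g) (onBoundary (down g)) (onBoundary (up g)) = refl

    right≡left-of-next : ∀ n m → γ∧ right (gridPoint n m) ≡ γ∧ left (gridPoint (suc n) m)
    right≡left-of-next n m rewrite gridIndex-suc n K with onBoundary (H ((+ n - + K) + 1ℤ) (+ m - + K)) in eq
    ... | false = trans (∧-zeroʳ _) (sym (∧-zeroʳ _))
    ... | true = cong (_∧ true) (trans (cong (λ z → γ (z , + m - + K)) (sym (i+1-1≡i (+ n - + K)))) (γ-closed (H ((+ n - + K) + 1ℤ) (+ m - + K)) eq))

    up≡down-of-next : ∀ n m → γ∧ up (gridPoint n m) ≡ γ∧ down (gridPoint n (suc m))
    up≡down-of-next n m rewrite gridIndex-suc m K with onBoundary (V (+ n - + K) ((+ m - + K) + 1ℤ)) in eq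
    ... | false = trans (∧-zeroʳ _) (sym (∧-zeroʳ _))
    ... | true = cong (_∧ true) (trans (cong (λ z → γ (+ n - + K , z)) (sym (i+1-1≡i (+ m - + K)))) (γ-closed (V (+ n - + K) ((+ m - + K) + 1ℤ)) eq))

    γ∧-outside : ∀ side g → inGridBox M g ≡ false → γ∧ side g ≡ false
    γ∧-outside side g out rewrite γ-outside g out = refl

    column0 : ∀ side → column (γ∧ side) 0 ≡ false
    column0 side = xorSum-false width _ (λ m → γ∧-outside side _ (cong (_∧ inGridRange M (+ m - + K)) index0-outside))

    columnWidth : ∀ side → column (γ∧ side) width ≡ false
    columnWidth side = xorSum-false width _ (λ m → γ∧-outside side _ (cong (_∧ inGridRange M (+ m - + K)) indexWidth-outside))

    row0 : ∀ side n → γ∧ side (gridPoint n 0) ≡ false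
    row0 side n = γ∧-outside side _ (trans (cong (inGridRange M (+ n - + K) ∧_) index0-outside) (∧-zeroʳ _))

    rowWidth : ∀ side n → γ∧ side (gridPoint n width) ≡ false
    rowWidth side n = γ∧-outside side _ (trans (cong (inGridRange M (+ n - + K) ∧_) indexWidth-outside) (∧-zeroʳ _))

    Σ²-right≡left : Σ² (γ∧ right) ≡ Σ² (γ∧ left)
    Σ²-right≡left = begin
      Σ² (γ∧ right)                                                        ≡⟨ xorSum-cong width _ _ (λ n → xorSum-cong width _ _ (right≡left-of-next n)) ⟩
      xorSum width (λ n → column (γ∧ left) (suc n))                        ≡⟨ xorSum-shift width (column (γ∧ left)) ⟩
      (Σ² (γ∧ left) xor column (γ∧ left) 0) xor column (γ∧ left) width    ≡⟨ cong₂ (λ p q → (Σ² (γ∧ left) xor p) xor q) (column0 left) (columnWidth left) ⟩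
      (Σ² (γ∧ left) xor false) xor false                                   ≡⟨ trans (xor-identityʳ _) (xor-identityʳ _) ⟩
      Σ² (γ∧ left)                                                         ∎
      where open ≡-Reasoning

    Σ²-up≡down : Σ² (γ∧ up) ≡ Σ² (γ∧ down)
    Σ²-up≡down = xorSum-cong width _ _ λ n → begin
      column (γ∧ up) n                                                                   ≡⟨ xorSum-cong width _ _ (up≡down-of-next n) ⟩
      xorSum width (λ m → γ∧ down (gridPoint n (suc m)))                                 ≡⟨ xorSum-shift width (λ m → γ∧ down (gridPoint n m)) ⟩
      (column (γ∧ down) n xor γ∧ down (gridPoint n 0)) xor γ∧ down (gridPoint n width)   ≡⟨ cong₂ (λ p q → (column (γ∧ down) n xor p) xor q) (row0 down n) (rowWidth down n) ⟩
      (column (γ∧ down) n xor false) xor false                                           ≡⟨ trans (xor-identityʳ _) (xor-identityʳ _) ⟩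
      column (γ∧ down) n                                                                 ∎
      where open ≡-Reasoning

    Σ²-γ∧degree≡false : Σ² (λ g → γ g ∧ degree g) ≡ false
    Σ²-γ∧degree≡false = begin
      Σ² (λ g → γ g ∧ degree g)                                                        ≡⟨ Σ²-cong γ∧degree-split ⟩
      Σ² (λ g → γ∧ left g xor (γ∧ right g xor (γ∧ down g xor γ∧ up g)))              ≡⟨ Σ²-xor (γ∧ left) (λ g → γ∧ right g xor (γ∧ down g xor γ∧ up g)) ⟩
      Σ² (γ∧ left) xor Σ² (λ g → γ∧ right g xor (γ∧ down g xor γ∧ up g))             ≡⟨ cong (Σ² (γ∧ left) xor_) (trans (Σ²-xor (γ∧ right) (λ g → γ∧ down g xor γ∧ up g)) (cong (Σ² (γ∧ right) xor_) (Σ²-xor (γ∧ down) (γ∧ up)))) ⟩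
      Σ² (γ∧ left) xor (Σ² (γ∧ right) xor (Σ² (γ∧ down) xor Σ² (γ∧ up)))            ≡⟨ cong₂ (λ r u → Σ² (γ∧ left) xor (r xor (Σ² (γ∧ down) xor u))) Σ²-right≡left Σ²-up≡down ⟩
      Σ² (γ∧ left) xor (Σ² (γ∧ left) xor (Σ² (γ∧ down) xor Σ² (γ∧ down)))            ≡⟨ cancel (Σ² (γ∧ left)) (Σ² (γ∧ down)) ⟩
      false                                                                            ∎
      where
      open ≡-Reasoning
      cancel : ∀ p q → p xor (p xor (q xor q)) ≡ false
      cancel = solve 2 (λ p q → p ⊕ (p ⊕ (q ⊕ q)) := con false) refl

    Σ²-γ∧degree≡cutEnds : Σ² (λ g → γ g ∧ degree g) ≡ γ (c , d) xor γ (c - 1ℤ , d)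
    Σ²-γ∧degree≡cutEnds =
      trans (Σ²-cong {f' = λ g → (γ g ∧ isPoint g (c , d)) xor (γ g ∧ isPoint g (c - 1ℤ , d))} (λ { (i , j) → trans (cong (γ (i , j) ∧_) (degree≡cutEnd i j)) (∧-distribˡ-xor (γ (i , j)) _ _) }))
      (trans (Σ²-xor (λ g → γ g ∧ isPoint g (c , d)) (λ g → γ g ∧ isPoint g (c - 1ℤ , d))) (cong₂ _xor_ (Σ²-isPoint (c , d)) (Σ²-isPoint (c - 1ℤ , d))))

    handshake : γ (c , d) ≡ γ (c - 1ℤ , d)
    handshake = xor≡false⇒≡ _ _ (trans (sym Σ²-γ∧degree≡cutEnds) Σ²-γ∧degree≡false)

-- x = (a , b) is the row-major last pixel of D and D' = D ∖ {x}; this leaves L, LL, B and BR as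
-- the only pixels of D' that can touch x.
record LastPixelSplit (M : ℕ) (D D' : Obj) (a b : ℤ) : Set where
  field
    bounded : Bounded M D
    mem→ : ∀ y → y ∈ D → y ≡ (a , b) ⊎ y ∈ D'
    mem← : ∀ y → y ≡ (a , b) ⊎ y ∈ D' → y ∈ D
    x∉D' : (a , b) ∉ D'
    x-last : ∀ p q → (p , q) ∈ D' → (q < b) ⊎ (q ≡ b × p < a)

module LastPixel {M : ℕ} {D D' : Obj} {a b : ℤ} (σ : LastPixelSplit M D D' a b) where

  open LastPixelSplit σ

  X L LL B BR R U UL UR : Pixel
  X = (a , b)
  L = nbr a b M1 Z0
  LL = nbr a b M1 M1
  B = nbr a b Z0 M1
  BR = nbr a b P1 M1
  R = nbr a b P1 Z0
  U = nbr a b Z0 P1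
  UL = nbr a b M1 P1
  UR = nbr a b P1 P1

  ∈D'⇒∈D : ∀ y → y ∈ D' → y ∈ D
  ∈D'⇒∈D y m = mem← y (inj₂ m)

  x∈D : X ∈ D
  x∈D = mem← X (inj₁ refl)

  bounded' : Bounded M D'
  bounded' y m = bounded y (∈D'⇒∈D y m)

  rowAbove∉D' : ∀ p → (p , b + 1ℤ) ∉ D'
  rowAbove∉D' p m with x-last p _ m
  ... | inj₁ lt = ZP.<-asym lt (i<i+1 b)
  ... | inj₂ (e , _) = i+1≢i b e

  rowAbove∉D : ∀ p → (p , b + 1ℤ) ∉ D
  rowAbove∉D p m with mem→ _ m
  ... | inj₁ e = i+1≢i b (cong proj₂ e)
  ... | inj₂ m' = rowAbove∉D' p m'

  R∉D' : R ∉ D'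
  R∉D' m with x-last _ _ m
  ... | inj₁ lt = ZP.<-irrefl refl lt
  ... | inj₂ (_ , lt) = ZP.<-asym lt (i<i+1 a)

  R∉D : R ∉ D
  R∉D m with mem→ _ m
  ... | inj₁ e = i+1≢i a (cong proj₁ e)
  ... | inj₂ m' = R∉D' m'

  module Ext = Exterior M D bounded
  module Ext' = Exterior M D' bounded'

  U-outside : Ext.Outside U
  U-outside = Ext.emptyRow⇒Outside (b + 1ℤ) rowAbove∉D a

  UL-outside : Ext.Outside UL
  UL-outside = Ext.emptyRow⇒Outside (b + 1ℤ) rowAbove∉D (a - 1ℤ)

  UR-outside : Ext.Outside UR
  UR-outside = Ext.emptyRow⇒Outside (b + 1ℤ) rowAbove∉D (a + 1ℤ)

  L-outside : L ∉ D → Ext.Outside L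
  L-outside n = Conn-step n (rowAbove∉D _) (Adj1-nbr a b M1 Z0 M1 P1) ◅◅ UL-outside

  R-outside : Ext.Outside R
  R-outside = Conn-step R∉D (rowAbove∉D _) (Adj1-nbr a b P1 Z0 P1 P1) ◅◅ UR-outside

  x-outside' : Ext'.Outside X
  x-outside' = Conn-step x∉D' (rowAbove∉D' _) (Adj1-nbr a b Z0 Z0 Z0 P1) ◅◅ Ext'.emptyRow⇒Outside (b + 1ℤ) rowAbove∉D' a

  B∉D' : B ∉ D → B ∉ D'
  B∉D' n m = n (∈D'⇒∈D _ m)

  B-outside' : B ∉ D → Ext'.Outside B
  B-outside' n = Conn-step (B∉D' n) x∉D' (Adj1-nbr a b Z0 M1 Z0 Z0) ◅◅ x-outside'

  Adj0-x⇒ : ∀ y → y ∈ D' → Adj0 y X → (y ≡ L) ⊎ (y ≡ LL) ⊎ (y ≡ B) ⊎ (y ≡ BR)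
  Adj0-x⇒ y m adj with Adj0⇒nbr y a b adj
  ... | M1 , Z0 , refl = inj₁ refl
  ... | M1 , M1 , refl = inj₂ (inj₁ refl)
  ... | Z0 , M1 , refl = inj₂ (inj₂ (inj₁ refl))
  ... | P1 , M1 , refl = inj₂ (inj₂ (inj₂ refl))
  ... | Z0 , Z0 , refl = ⊥-elim (x∉D' m)
  ... | P1 , Z0 , refl = ⊥-elim (R∉D' m)
  ... | M1 , P1 , refl = ⊥-elim (rowAbove∉D' _ m)
  ... | Z0 , P1 , refl = ⊥-elim (rowAbove∉D' _ m)
  ... | P1 , P1 , refl = ⊥-elim (rowAbove∉D' _ m)

  Adj1-x⇒ : ∀ y → Adj1 y X → (y ≡ L) ⊎ (y ≡ R) ⊎ (y ≡ U) ⊎ (y ≡ B)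
  Adj1-x⇒ y adj = Adj1⇒nbr y a b adj

  module Paths0 = PathsThroughPoint (λ y → y ∈ D) (λ y → y ∈ D') Adj0 X mem→ ∈D'⇒∈D x∉D' Adj0-sym Conn0-sym

  components-isolated : ∀ {c'} → (∀ y → y ∈ D' → ¬ Adj0 y X) → Components D' c' → Components D (suc c')
  components-isolated nonb (Lr , refl , al , ap , cov) = X ∷ Lr , refl , x∈D ∷ All.map (∈D'⇒∈D _) al , hd ∷ AllPairs-restrict al ap separated , covers
    where
    hd : All (λ r → ¬ Comp0 D X r) Lr
    hd = All.map (λ {r} rm c → h r rm c) al
      where
      h : ∀ r → r ∈ D' → ¬ Comp0 D X r
      h r rm c with Paths0.split c
      ... | inj₁ c' with Conn-from-outside c' x∉D'
      ...   | refl = x∉D' rm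
      h r rm c | inj₂ (_ , inj₁ refl) = x∉D' rm
      h r rm c | inj₂ (_ , inj₂ (nb , nbm , nba , _)) = nonb nb nbm nba
    separated : ∀ u v → u ∈ D' → v ∈ D' → ¬ Comp0 D' u v → ¬ Comp0 D u v
    separated u v um vm n c with Paths0.split c
    ... | inj₁ c' = n c'
    ... | inj₂ (inj₁ refl , _) = x∉D' um
    ... | inj₂ (inj₂ (nb , nbm , nba , _) , _) = nonb nb nbm nba
    covers : ∀ y → y ∈ D → Any (Comp0 D y) (X ∷ Lr)
    covers y m with mem→ y m
    ... | inj₁ refl = here ε
    ... | inj₂ m' = there (Any.map (λ c → Conn-mono (∈D'⇒∈D) c) (cov y m'))

  components-attach : ∀ {c'} nb0 → nb0 ∈ D' → Adj0 nb0 X → (∀ y → y ∈ D' → Adj0 y X → Comp0 D' y nb0) → Components D' c' → Components D c'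
  components-attach nb0 nm na all0 (Lr , refl , al , ap , cov) = Lr , refl , All.map (∈D'⇒∈D _) al , AllPairs-restrict al ap separated , covers
    where
    ViaNeighbour⇒Conn-nb0 : ∀ u → Paths0.ViaNeighbour u → Comp0 D' u nb0
    ViaNeighbour⇒Conn-nb0 u (nb , nbm , nba , c) = c ◅◅ all0 nb nbm nba
    separated : ∀ u v → u ∈ D' → v ∈ D' → ¬ Comp0 D' u v → ¬ Comp0 D u v
    separated u v um vm n c with Paths0.split c
    ... | inj₁ c' = n c'
    ... | inj₂ (inj₁ refl , _) = x∉D' um
    ... | inj₂ (inj₂ _ , inj₁ refl) = x∉D' vm
    ... | inj₂ (inj₂ tu , inj₂ tv) = n (ViaNeighbour⇒Conn-nb0 u tu ◅◅ Conn0-sym (ViaNeighbour⇒Conn-nb0 v tv))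
    covers : ∀ y → y ∈ D → Any (Comp0 D y) Lr
    covers y m with mem→ y m
    ... | inj₁ refl = Any.map (λ c → Conn-step x∈D (∈D'⇒∈D _ nm) (Adj0-sym nb0 X na) ◅◅ Conn-mono ∈D'⇒∈D c) (cov nb0 nm)
    ... | inj₂ m' = Any.map (λ c → Conn-mono ∈D'⇒∈D c) (cov y m')

  components-merge : ∀ {c'} n1 n2 → n1 ∈ D' → n2 ∈ D' → Adj0 n1 X → Adj0 n2 X → ¬ Comp0 D' n1 n2 →
    (∀ y → y ∈ D' → Adj0 y X → Comp0 D' y n1 ⊎ Comp0 D' y n2) → Components D' c' → Σ ℕ λ c → Components D c × suc c ≡ c'
  components-merge n1 n2 m1 m2 a1 a2 n12 all12 (Lr , refl , al , ap , cov) with Any-split (cov n2 m2)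
  ... | pre , r2 , post , refl , c2 =
    length (pre ++ post) , (pre ++ post , refl , All.map (∈D'⇒∈D _) al' , AllPairs-restrict al2 (AllPairs-remove pre r2 post ap) separated , covers) ,
    sym (LP.length-++-sucʳ pre r2 post)
    where
    al' : All (λ y → y ∈ D') (pre ++ post)
    al' = All-remove pre r2 post al
    al2 : All (λ y → y ∈ D' × y ∈ pre ++ post) (pre ++ post)
    al2 = All.tabulate (λ {y} m → All.lookup al' m , m)
    ¬Conn-r2 : ∀ u → u ∈ pre ++ post → ¬ Comp0 D' u r2
    ¬Conn-r2 u m c with AllPairs-middle pre r2 post ap u m
    ... | inj₁ n = n c
    ... | inj₂ n = n (Conn0-sym c)
    ViaNeighbour⇒Conn-n1 : ∀ u → u ∈ pre ++ post → Paths0.ViaNeighbour u → Comp0 D' u n1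
    ViaNeighbour⇒Conn-n1 u m (nb , nbm , nba , c) with all12 nb nbm nba
    ... | inj₁ c1 = c ◅◅ c1
    ... | inj₂ c2' = ⊥-elim (¬Conn-r2 u m (c ◅◅ c2' ◅◅ c2))
    separated : ∀ u v → u ∈ D' × u ∈ pre ++ post → v ∈ D' × v ∈ pre ++ post → ¬ Comp0 D' u v → ¬ Comp0 D u v
    separated u v (um , um2) (vm , vm2) n c with Paths0.split c
    ... | inj₁ c' = n c'
    ... | inj₂ (inj₁ refl , _) = x∉D' um
    ... | inj₂ (inj₂ _ , inj₁ refl) = x∉D' vm
    ... | inj₂ (inj₂ tu , inj₂ tv) = n (ViaNeighbour⇒Conn-n1 u um2 tu ◅◅ Conn0-sym (ViaNeighbour⇒Conn-n1 v vm2 tv))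
    xn1 : Comp0 D X n1
    xn1 = Conn-step x∈D (∈D'⇒∈D _ m1) (Adj0-sym n1 X a1)
    n1rep : Any (Comp0 D n1) (pre ++ post)
    n1rep with Any-middle pre r2 post (cov n1 m1)
    ... | inj₁ a' = Any.map (λ c → Conn-mono ∈D'⇒∈D c) a'
    ... | inj₂ c' = ⊥-elim (n12 (c' ◅◅ Conn0-sym c2))
    covers : ∀ y → y ∈ D → Any (Comp0 D y) (pre ++ post)
    covers y m with mem→ y m
    ... | inj₁ refl = Any.map (λ c → xn1 ◅◅ c) n1rep
    ... | inj₂ m' with Any-middle pre r2 post (cov y m')
    ...   | inj₁ a' = Any.map (λ c → Conn-mono ∈D'⇒∈D c) a'
    ...   | inj₂ c' = Any.map (λ c → Conn-mono ∈D'⇒∈D (c' ◅◅ Conn0-sym c2) ◅◅ Conn-step (∈D'⇒∈D _ m2) x∈D a2 ◅◅ xn1 ◅◅ c) n1rep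

  big→ : ∀ y → y ∉ D' → y ≡ X ⊎ y ∉ D
  big→ y n with y ≟ᵖ X
  ... | yes e = inj₁ e
  ... | no ne = inj₂ h
    where
    h : y ∉ D
    h m with mem→ y m
    ... | inj₁ e = ne e
    ... | inj₂ m' = n m'

  small→ : ∀ y → y ∉ D → y ∉ D'
  small→ y n m = n (∈D'⇒∈D y m)

  module Paths1ᶜ = PathsThroughPoint (Compl D') (Compl D) Adj1 X big→ small→ (λ n → n x∈D) Adj1-sym Conn1-sym

  hole'≢x : ∀ r → InHole D' r → ¬ r ≡ X
  hole'≢x r (_ , fin) refl = Ext'.Outside⇒¬Finite X x-outside' fin

  hole'∉D : ∀ r → InHole D' r → r ∉ D
  hole'∉D r h m with mem→ r m
  ... | inj₁ e = hole'≢x r h e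
  ... | inj₂ m' = proj₁ h m'

  hole'-finite : ∀ r → InHole D' r → Ext.Finite r
  hole'-finite r (_ , (Ls , f)) = Ls , λ z c → f z (Conn-mono small→ c)

  hole'⇒hole : ∀ r → InHole D' r → InHole D r
  hole'⇒hole r h = hole'∉D r h , hole'-finite r h

  Finite⇒∈box : ∀ y → Ext.Finite y → y ∈ box M
  Finite⇒∈box (p , q) fin with inR? M p | inR? M q
  ... | yes u | yes v = ∈box M _ (u , v)
  ... | no u | _ = ⊥-elim (Ext.Outside⇒¬Finite _ (Ext.¬InBox⇒Outside _ (λ z → u (proj₁ z))) fin)
  ... | yes _ | no v = ⊥-elim (Ext.Outside⇒¬Finite _ (Ext.¬InBox⇒Outside _ (λ z → v (proj₂ z))) fin)

  holes-unchanged : ∀ {h'} → (∀ nb → nb ∉ D → Adj1 nb X → Ext.Outside nb) → Holes D' h' → Holes D h'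
  holes-unchanged nbrs-outside (Lr , refl , al , ap , cov) =
    Lr , refl , All.map (λ {r} h → hole'⇒hole r h) al , AllPairs-restrict al ap (λ u v _ _ n c → n (Conn-mono small→ c)) , covers
    where
    ¬ViaPoint : ∀ y → y ∉ D → Ext.Finite y → ¬ Paths1ᶜ.ViaPoint y
    ¬ViaPoint y nyD fin (inj₁ refl) = nyD x∈D
    ¬ViaPoint y nyD fin (inj₂ (nb , nbn , nba , c)) = Ext.Outside⇒¬Finite y (c ◅◅ nbrs-outside nb nbn nba) fin
    covers : ∀ y → InHole D y → Any (CompCompl1 D y) Lr
    covers y (nyD , fin) = Any.map (conv _) (cov y (small→ y nyD , Ext'.¬Outside⇒Finite y ni))
      where
      ni : ¬ Ext'.Outside y
      ni inf with Paths1ᶜ.split inf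
      ... | inj₁ c = Ext.Outside⇒¬Finite y c fin
      ... | inj₂ (ty , _) = ¬ViaPoint y nyD fin ty
      conv : ∀ z → CompCompl1 D' y z → CompCompl1 D y z
      conv z c with Paths1ᶜ.split c
      ... | inj₁ c' = c'
      ... | inj₂ (ty , _) = ⊥-elim (¬ViaPoint y nyD fin ty)

  holes-new : ∀ {h'} → B ∉ D → ¬ Ext.Outside B → (∀ nb → nb ∉ D → Adj1 nb X → Ext.Outside nb ⊎ Ext.Conn1ᶜ nb B) →
    (∀ y → y ∈ box M → Dec (Ext'.Outside y)) → Holes D' h' → Holes D (suc h')
  holes-new nBD niB nbrs-outside-or-B decI (Lr , refl , al , ap , cov) =
    B ∷ Lr , refl , (nBD , Ext.¬Outside⇒Finite B niB) ∷ All.map (λ {r} h → hole'⇒hole r h) al ,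
    All.map (λ {r} h c → Ext'.Outside⇒¬Finite r (Conn1-sym (Conn-mono small→ c) ◅◅ B-outside' nBD) (proj₂ h)) al ∷
    AllPairs-restrict al ap (λ u v _ _ n c → n (Conn-mono small→ c)) , covers
    where
    ViaPoint⇒Conn-B : ∀ y → y ∉ D → Ext.Finite y → Paths1ᶜ.ViaPoint y → Ext.Conn1ᶜ y B
    ViaPoint⇒Conn-B y nyD fin (inj₁ refl) = ⊥-elim (nyD x∈D)
    ViaPoint⇒Conn-B y nyD fin (inj₂ (nb , nbn , nba , c)) with nbrs-outside-or-B nb nbn nba
    ... | inj₁ inf = ⊥-elim (Ext.Outside⇒¬Finite y (c ◅◅ inf) fin)
    ... | inj₂ cb = c ◅◅ cb
    covers : ∀ y → InHole D y → Any (CompCompl1 D y) (B ∷ Lr)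
    covers y (nyD , fin) with decI y (Finite⇒∈box y fin)
    ... | yes inf with Paths1ᶜ.split inf
    ...   | inj₁ c = ⊥-elim (Ext.Outside⇒¬Finite y c fin)
    ...   | inj₂ (ty , _) = here (ViaPoint⇒Conn-B y nyD fin ty)
    covers y (nyD , fin) | no ni = conv (cov y (small→ y nyD , Ext'.¬Outside⇒Finite y ni))
      where
      conv : ∀ {Ls} → Any (CompCompl1 D' y) Ls → Any (CompCompl1 D y) (B ∷ Ls)
      conv (here c) with Paths1ᶜ.split c
      ... | inj₁ c' = there (here c')
      ... | inj₂ (ty , _) = here (ViaPoint⇒Conn-B y nyD fin ty)
      conv (there a') with conv a'
      ... | here c = here c
      ... | there a'' = there (there a'')

module Enclosure {M : ℕ} {D D' : Obj} {a b : ℤ} (σ : LastPixelSplit M D D' a b) where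

  open LastPixelSplit σ

  open LastPixel σ

  g1 g2 : GridPoint
  g1 = (a - 1ℤ , b - 1ℤ)
  g2 = (a , b - 1ℤ)
  e0 : Edge
  e0 = H a (b - 1ℤ)

  BoundaryEdge : (Pixel → Bool) → Edge → Bool
  BoundaryEdge κ e = (κ (pix₁ e) xor κ (pix₂ e)) ∧ not (sameEdge e e0)

  Reach : (Pixel → Bool) → GridPoint → GridPoint → Set
  Reach κ = Star (λ u w → Σ Edge λ e → BoundaryEdge κ e ≡ true × Joins e u w)

  x-B-edge≡e0 : ∀ e → (pix₁ e ≡ X × pix₂ e ≡ B) ⊎ (pix₂ e ≡ X × pix₁ e ≡ B) → sameEdge e e0 ≡ true
  x-B-edge≡e0 (H i j) (inj₁ (p , q)) = ⊥-elim (i-1≢i+1 b (sym (trans (cong (_+ 1ℤ) (sym (cong proj₂ p))) (cong proj₂ q))))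
  x-B-edge≡e0 (H i j) (inj₂ (p , refl)) = sameEdge-refl (H a (b - 1ℤ))
  x-B-edge≡e0 (V i j) (inj₁ (p , q)) = ⊥-elim (i-1≢i b (trans (sym (cong proj₂ q)) (cong proj₂ p)))
  x-B-edge≡e0 (V i j) (inj₂ (p , q)) = ⊥-elim (i-1≢i b (trans (sym (cong proj₂ q)) (cong proj₂ p)))

  inBox? : ∀ y → Dec (InBox M y)
  inBox? (p , q) with inR? M p | inR? M q
  ... | yes u | yes v = yes (u , v)
  ... | no u | _ = no (λ z → u (proj₁ z))
  ... | yes _ | no v = no (λ z → v (proj₂ z))

  module ComponentOfB (nBD : B ∉ D) (niB : ¬ Ext.Outside B) (dK : ∀ y → y ∈ box M → Dec (Ext.Conn1ᶜ B y)) where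
    κ : Pixel → Bool
    κ y with inBox? y
    ... | yes ib = ⌊ dK y (∈box M y ib) ⌋
    ... | no _ = false

    κ-sound : ∀ y → κ y ≡ true → Ext.Conn1ᶜ B y
    κ-sound y p with inBox? y
    ... | yes ib with dK y (∈box M y ib)
    ...   | yes c = c
    κ-sound y () | yes ib | no _
    κ-sound y () | no _

    κ-box : ∀ y → κ y ≡ true → InBox M y
    κ-box y p with inBox? y
    ... | yes ib = ib
    κ-box y () | no _

    κ-complete : ∀ y → Ext.Conn1ᶜ B y → κ y ≡ true
    κ-complete y c with inBox? y
    ... | yes ib with dK y (∈box M y ib)
    ...   | yes _ = refl
    ...   | no n = ⊥-elim (n c)
    κ-complete y c | no nb = ⊥-elim (niB (c ◅◅ Ext.¬InBox⇒Outside y nb))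

    G : Edge → Bool
    G = BoundaryEdge κ

    BoundarySides : Edge → Set
    BoundarySides e = Σ Pixel λ P → Σ Pixel λ Q → κ P ≡ false × κ Q ≡ true × ((P ≡ pix₁ e × Q ≡ pix₂ e) ⊎ (P ≡ pix₂ e × Q ≡ pix₁ e))

    boundarySides : ∀ e → G e ≡ true → BoundarySides e
    boundarySides e g with κ (pix₁ e) in ea | κ (pix₂ e) in eb
    ... | true | false = pix₂ e , pix₁ e , eb , ea , inj₂ (refl , refl)
    ... | false | true = pix₁ e , pix₂ e , ea , eb , inj₁ (refl , refl)
    boundarySides e () | true | true
    boundarySides e () | false | false

    onBoundary⇒≢e0 : ∀ e → G e ≡ true → sameEdge e e0 ≡ false
    onBoundary⇒≢e0 e g with sameEdge e e0
    ... | false = refl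
    onBoundary⇒≢e0 e g | true with κ (pix₁ e) xor κ (pix₂ e)
    onBoundary⇒≢e0 e () | true | true
    onBoundary⇒≢e0 e () | true | false

    outerPixel : ∀ e → G e ≡ true → Pixel
    outerPixel e g = proj₁ (boundarySides e g)

    sides-Adj1 : ∀ e {P Q} → ((P ≡ pix₁ e × Q ≡ pix₂ e) ⊎ (P ≡ pix₂ e × Q ≡ pix₁ e)) → Adj1 Q P
    sides-Adj1 e (inj₁ (refl , refl)) = Adj1-sym (pix₁ e) (pix₂ e) (pix₁-Adj1-pix₂ e)
    sides-Adj1 e (inj₂ (refl , refl)) = pix₁-Adj1-pix₂ e

    sides-sym : ∀ {e P Q} → ((P ≡ pix₁ e × Q ≡ pix₂ e) ⊎ (P ≡ pix₂ e × Q ≡ pix₁ e)) →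
      ((pix₁ e ≡ P × pix₂ e ≡ Q) ⊎ (pix₂ e ≡ P × pix₁ e ≡ Q))
    sides-sym (inj₁ (p , q)) = inj₁ (sym p , sym q)
    sides-sym (inj₂ (p , q)) = inj₂ (sym p , sym q)

    -- The pixel across a boundary edge of B's component lies in D, and it is not x since the
    -- only edge between x and that component is e0.
    outerPixel∈D' : ∀ e (g : G e ≡ true) → outerPixel e g ∈ D'
    outerPixel∈D' e g with boundarySides e g
    ... | P , Q , kP , kQ , orr = res
      where
      cQ : Ext.Conn1ᶜ B Q
      cQ = κ-sound Q kQ
      Q∉D : Q ∉ D
      Q∉D m with Conn-to-outside cQ (λ n → n m)
      ... | refl = nBD m
      adjQP : Adj1 Q P
      adjQP = sides-Adj1 e orr
      res : P ∈ D'
      res with P ∈? D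
      ... | no nPD = ⊥-elim (f≢t (trans (sym kP) (κ-complete P (cQ ◅◅ Conn-step Q∉D nPD adjQP))))
        where
        f≢t : ¬ false ≡ true
        f≢t ()
      ... | yes PD with mem→ P PD
      ...   | inj₂ m = m
      ...   | inj₁ refl with Adj1-x⇒ Q adjQP
      ...     | inj₁ refl = ⊥-elim (niB (cQ ◅◅ L-outside Q∉D))
      ...     | inj₂ (inj₁ refl) = ⊥-elim (niB (cQ ◅◅ R-outside))
      ...     | inj₂ (inj₂ (inj₁ refl)) = ⊥-elim (niB (cQ ◅◅ U-outside))
      ...     | inj₂ (inj₂ (inj₂ refl)) = ⊥-elim (t≢f (trans (sym (x-B-edge≡e0 e orr')) (onBoundary⇒≢e0 e g)))
        where
        t≢f : ¬ true ≡ false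
        t≢f ()
        orr' : (pix₁ e ≡ X × pix₂ e ≡ B) ⊎ (pix₂ e ≡ X × pix₁ e ≡ B)
        orr' = sides-sym orr

    outerPixel-vertex : ∀ e (g : G e ≡ true) gp → (end₁ e ≡ gp ⊎ end₂ e ≡ gp) → HasVertex (outerPixel e g) gp
    outerPixel-vertex e g gp en with boundarySides e g
    ... | P , Q , _ , _ , inj₁ (refl , _) with en
    ...   | inj₁ refl = pix₁-end₁ e
    ...   | inj₂ refl = pix₁-end₂ e
    outerPixel-vertex e g gp en | P , Q , _ , _ , inj₂ (refl , _) with en
    ...   | inj₁ refl = pix₂-end₁ e
    ...   | inj₂ refl = pix₂-end₂ e

    Joins-start : ∀ {e u w} → Joins e u w → end₁ e ≡ u ⊎ end₂ e ≡ u
    Joins-start (inj₁ (p , _)) = inj₁ p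
    Joins-start (inj₂ (p , _)) = inj₂ p

    Joins-end : ∀ {e u w} → Joins e u w → end₁ e ≡ w ⊎ end₂ e ≡ w
    Joins-end (inj₁ (_ , q)) = inj₂ q
    Joins-end (inj₂ (_ , q)) = inj₁ q

    reach⇒Conn0-BR : ∀ gp → Reach κ gp g2 → BR ∈ D' → ∀ e (g : G e ≡ true) → (end₁ e ≡ gp ⊎ end₂ e ≡ gp) → Comp0 D' (outerPixel e g) BR
    reach⇒Conn0-BR gp ε brm e g en = Conn-step (outerPixel∈D' e g) brm (commonVertex⇒Adj0 _ _ g2 (outerPixel-vertex e g g2 en) (inj₂ refl , inj₁ refl))
    reach⇒Conn0-BR gp ((e' , g' , en') ◅ rest) brm e g en =
      Conn-step (outerPixel∈D' e g) (outerPixel∈D' e' g') (commonVertex⇒Adj0 _ _ gp (outerPixel-vertex e g gp en) (outerPixel-vertex e' g' gp (Joins-start en')))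
      ◅◅ reach⇒Conn0-BR _ rest brm e' g' (Joins-end en')

    reach⇒Conn0′ : ∀ N gs → N ∈ D' → HasVertex N gs → gs ≡ g1 → BR ∈ D' → Reach κ gs g2 → Comp0 D' N BR
    reach⇒Conn0′ N gs nm vN eq brm ε = ⊥-elim (i-1≢i a (sym (cong proj₁ eq)))
    reach⇒Conn0′ N gs nm vN eq brm r@((e , g , en) ◅ rest) =
      Conn-step nm (outerPixel∈D' e g) (commonVertex⇒Adj0 _ _ gs vN (outerPixel-vertex e g gs (Joins-start en))) ◅◅ reach⇒Conn0-BR gs r brm e g (Joins-start en)

    reach⇒Conn0 : ∀ N → N ∈ D' → HasVertex N g1 → BR ∈ D' → Reach κ g1 g2 → Comp0 D' N BR
    reach⇒Conn0 N nm vN brm r = reach⇒Conn0′ N g1 nm vN refl brm r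

    module ReachableFromCorner (dR : ∀ g → g ∈ gridBox M → Dec (Reach κ g1 g)) where
      γ′ : ∀ g (t : Bool) → inGridBox M g ≡ t → Bool
      γ′ g true eq = ⌊ dR g (∈gridBox M g eq) ⌋
      γ′ g false _ = false

      γ : GridPoint → Bool
      γ g = γ′ g (inGridBox M g) refl

      γ′-sound : ∀ g t eq → γ′ g t eq ≡ true → Reach κ g1 g
      γ′-sound g true eq p with dR g (∈gridBox M g eq)
      ... | yes r = r
      γ′-sound g true eq () | no _
      γ′-sound g false eq ()

      γ-sound : ∀ g → γ g ≡ true → Reach κ g1 g
      γ-sound g p = γ′-sound g (inGridBox M g) refl p

      γ′-complete : ∀ g t (eq : inGridBox M g ≡ t) → t ≡ true → Reach κ g1 g → γ′ g t eq ≡ true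
      γ′-complete g true eq _ r with dR g (∈gridBox M g eq)
      ... | yes _ = refl
      ... | no n = ⊥-elim (n r)

      γ-complete : ∀ g → inGridBox M g ≡ true → Reach κ g1 g → γ g ≡ true
      γ-complete g ib r = γ′-complete g (inGridBox M g) refl ib r

      γ′-inGridBox : ∀ g t (eq : inGridBox M g ≡ t) → γ′ g t eq ≡ true → inGridBox M g ≡ true
      γ′-inGridBox g true eq _ = eq
      γ′-inGridBox g false eq ()

      γ-inGridBox : ∀ g → γ g ≡ true → inGridBox M g ≡ true
      γ-inGridBox g p = γ′-inGridBox g (inGridBox M g) refl p

      module HH = Handshake M κ γ a (b - 1ℤ)

      κB : κ B ≡ true
      κB = κ-complete B ε

      κx : κ (a , (b - 1ℤ) + 1ℤ) ≡ false
      κx with κ (a , (b - 1ℤ) + 1ℤ) in eq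
      ... | false = refl
      ... | true with Conn-to-outside (subst (λ z → Ext.Conn1ᶜ B (a , z)) (i-1+1≡i b) (κ-sound _ eq)) (λ n → n x∈D)
      ...   | e = ⊥-elim (i-1≢i b (cong proj₂ e))

      cut-separates : HH.separates HH.cut ≡ true
      cut-separates rewrite κB | κx = refl

      boundary-inBox : ∀ e → G e ≡ true → InBox M (pix₁ e) ⊎ InBox M (pix₂ e)
      boundary-inBox e g with boundarySides e g
      ... | P , Q , _ , kQ , inj₁ (_ , refl) = inj₂ (κ-box _ kQ)
      ... | P , Q , _ , kQ , inj₂ (_ , refl) = inj₁ (κ-box _ kQ)

      γ-closed : ∀ e → HH.onBoundary e ≡ true → γ (end₁ e) ≡ γ (end₂ e)
      γ-closed e g with edge-inGridBox M e (boundary-inBox e g)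
      ... | iA , iB with γ (end₁ e) in ea | γ (end₂ e) in eb
      ... | true | true = refl
      ... | false | false = refl
      ... | true | false = ⊥-elim (t≢f (trans (sym (γ-complete (end₂ e) iB (γ-sound _ ea ◅◅ ((e , g , inj₁ (refl , refl)) ◅ ε)))) eb))
        where
        t≢f : ¬ true ≡ false
        t≢f ()
      ... | false | true = ⊥-elim (t≢f (trans (sym (γ-complete (end₁ e) iA (γ-sound _ eb ◅◅ ((e , g , inj₂ (refl , refl)) ◅ ε)))) ea))
        where
        t≢f : ¬ true ≡ false
        t≢f ()

      corners-linked : γ g2 ≡ γ g1
      corners-linked = HH.handshake cut-separates γ-closed γ-inGridBox

      x-inBox : InBox M X
      x-inBox = bounded X x∈D

      g1-inGridBox : inGridBox M g1 ≡ true
      g1-inGridBox = true∧true (InR⇒inGridRange-1 M a (proj₁ x-inBox)) (InR⇒inGridRange-1 M b (proj₂ x-inBox))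

      g1-reaches-g2 : Reach κ g1 g2
      g1-reaches-g2 = γ-sound g2 (trans corners-linked (γ-complete g1 g1-inGridBox ε))

enclosed⇒Conn0 : ∀ {M : ℕ} {D D' : Obj} {a b : ℤ} (σ : LastPixelSplit M D D' a b) →
  let open LastPixel σ in
  ∀ N → N ∈ D' → HasVertex N (a - 1ℤ , b - 1ℤ) → BR ∈ D' → (nBD : B ∉ D) → (niB : ¬ Ext.Outside B) → ¬ ¬ (Comp0 D' N BR)
enclosed⇒Conn0 {M} σ N nm vN brm nBD niB =
  ¬¬-decidableOn (Ext.Conn1ᶜ B) (box M) >>= λ dK →
  ¬¬-decidableOn (Reach (ComponentOfB.κ nBD niB dK) g1) (gridBox M) >>= λ dR →
  pure (ComponentOfB.reach⇒Conn0 nBD niB dK N nm vN brm (ComponentOfB.ReachableFromCorner.g1-reaches-g2 nBD niB dK dR))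
  where
  open Enclosure σ
  open LastPixel σ

gridBox-unique : ∀ M → Unique (gridBox M)
gridBox-unique M = UP.cartesianProduct⁺ (range-unique -[1+ M ] (suc (suc (M ℕ.+ M)))) (range-unique -[1+ M ] (suc (suc (M ℕ.+ M))))

potential : ℕ → Obj → ℤ
potential M D = sumL (Ψ D) (gridBox M)

module PotentialStep {M : ℕ} {D D' : Obj} {a b : ℤ} (σ : LastPixelSplit M D D' a b) where

  open LastPixelSplit σ

  open LastPixel σ

  memberᵇ-unchanged : ∀ y → ¬ y ≡ X → memberᵇ D y ≡ memberᵇ D' y
  memberᵇ-unchanged y ne with y ∈? D' 
  ... | yes m = ∈⇒memberᵇ (∈D'⇒∈D y m)
  ... | no n = ∉⇒memberᵇ-false h
    where
    h : y ∉ D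
    h m with mem→ y m
    ... | inj₁ e = ne e
    ... | inj₂ m' = n m'

  x-inBox : InBox M X
  x-inBox = bounded X x∈D

  c1 c2 c3 c4 : GridPoint
  c1 = (a , b)
  c2 = (a - 1ℤ , b)
  c3 = (a , b - 1ℤ)
  c4 = (a - 1ℤ , b - 1ℤ)

  c1∈gridBox : c1 ∈ gridBox M
  c1∈gridBox = ∈gridBox M c1 (true∧true (InR⇒inGridRange M a (proj₁ x-inBox)) (InR⇒inGridRange M b (proj₂ x-inBox)))
  c2∈gridBox : c2 ∈ gridBox M
  c2∈gridBox = ∈gridBox M c2 (true∧true (InR⇒inGridRange-1 M a (proj₁ x-inBox)) (InR⇒inGridRange M b (proj₂ x-inBox)))
  c3∈gridBox : c3 ∈ gridBox M
  c3∈gridBox = ∈gridBox M c3 (true∧true (InR⇒inGridRange M a (proj₁ x-inBox)) (InR⇒inGridRange-1 M b (proj₂ x-inBox)))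
  c4∈gridBox : c4 ∈ gridBox M
  c4∈gridBox = ∈gridBox M c4 (true∧true (InR⇒inGridRange-1 M a (proj₁ x-inBox)) (InR⇒inGridRange-1 M b (proj₂ x-inBox)))

  Ψ-unchanged-elsewhere : ∀ g → ¬ g ≡ c1 → ¬ g ≡ c2 → ¬ g ≡ c3 → ¬ g ≡ c4 → Ψ D g ≡ Ψ D' g
  Ψ-unchanged-elsewhere (i , j) n1 n2 n3 n4
    rewrite memberᵇ-unchanged (i , j) n1
          | memberᵇ-unchanged (i + 1ℤ , j) (λ e → n2 (cong₂ _,_ (trans (sym (i+1-1≡i i)) (cong (λ z → z - 1ℤ) (cong proj₁ e))) (cong proj₂ e)))
          | memberᵇ-unchanged (i , j + 1ℤ) (λ e → n3 (cong₂ _,_ (cong proj₁ e) (trans (sym (i+1-1≡i j)) (cong (λ z → z - 1ℤ) (cong proj₂ e)))))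
          | memberᵇ-unchanged (i + 1ℤ , j + 1ℤ) (λ e → n4 (cong₂ _,_ (trans (sym (i+1-1≡i i)) (cong (λ z → z - 1ℤ) (cong proj₁ e))) (trans (sym (i+1-1≡i j)) (cong (λ z → z - 1ℤ) (cong proj₂ e))))) = refl

  n12 : ¬ c1 ≡ c2
  n12 e = i-1≢i a (sym (cong proj₁ e))
  n13 : ¬ c1 ≡ c3
  n13 e = i-1≢i b (sym (cong proj₂ e))
  n14 : ¬ c1 ≡ c4
  n14 e = i-1≢i a (sym (cong proj₁ e))
  n23 : ¬ c2 ≡ c3
  n23 e = i-1≢i a (cong proj₁ e)
  n24 : ¬ c2 ≡ c4
  n24 e = i-1≢i b (sym (cong proj₂ e))
  n34 : ¬ c3 ≡ c4
  n34 e = i-1≢i a (sym (cong proj₁ e))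

  potential-step : potential M D ≡ potential M D' + Δψ (memberᵇ D' L) (memberᵇ D' LL) (memberᵇ D' B) (memberᵇ D' BR)
  potential-step = trans (sumL-update4 (Ψ D) (Ψ D') (gridBox M) (gridBox-unique M) c1 c2 c3 c4 c1∈gridBox c2∈gridBox c3∈gridBox c4∈gridBox n12 n13 n14 n23 n24 n34 Ψ-unchanged-elsewhere)
                   (cong (λ w → potential M D' + w) Δψ-at-corners)
    where
    Δψ-at-corners : ((Ψ D c1 - Ψ D' c1) + (Ψ D c2 - Ψ D' c2)) + ((Ψ D c3 - Ψ D' c3) + (Ψ D c4 - Ψ D' c4))
              ≡ Δψ (memberᵇ D' L) (memberᵇ D' LL) (memberᵇ D' B) (memberᵇ D' BR)
    Δψ-at-corners rewrite i-1+1≡i a | i-1+1≡i b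
      | ∈⇒memberᵇ {D} x∈D | ∉⇒memberᵇ-false {D'} x∉D' | ∉⇒memberᵇ-false {D} R∉D | ∉⇒memberᵇ-false {D'} R∉D'
      | ∉⇒memberᵇ-false {D} (rowAbove∉D a) | ∉⇒memberᵇ-false {D'} (rowAbove∉D' a)
      | ∉⇒memberᵇ-false {D} (rowAbove∉D (a + 1ℤ)) | ∉⇒memberᵇ-false {D'} (rowAbove∉D' (a + 1ℤ))
      | ∉⇒memberᵇ-false {D} (rowAbove∉D (a - 1ℤ)) | ∉⇒memberᵇ-false {D'} (rowAbove∉D' (a - 1ℤ))
      | memberᵇ-unchanged L (λ e → i-1≢i a (cong proj₁ e)) | memberᵇ-unchanged LL (λ e → i-1≢i a (cong proj₁ e))
      | memberᵇ-unchanged B (λ e → i-1≢i b (cong proj₂ e)) | memberᵇ-unchanged BR (λ e → i+1≢i a (cong proj₁ e)) = refl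

PotentialFormula : ℕ → Obj → Set
PotentialFormula M D = Σ ℕ λ c → Σ ℕ λ h → Components D c × Holes D h × potential M D ≡ + 2 * (+ length D + + c - + h)

formula-attach : ∀ s p c h → s ≡ + 2 * (+ p + + c - + h) → s + + 2 ≡ + 2 * (+ suc p + + c - + h)
formula-attach s p c h e rewrite e = ZS.solve 3 (λ p c h → ZS.con (+ 2) ZS.:* (p ZS.:+ c ZS.:- h) ZS.:+ ZS.con (+ 2) ZS.:= ZS.con (+ 2) ZS.:* (ZS.con 1ℤ ZS.:+ p ZS.:+ c ZS.:- h)) refl (+ p) (+ c) (+ h)

formula-isolated : ∀ s p c h → s ≡ + 2 * (+ p + + c - + h) → s + + 4 ≡ + 2 * (+ suc p + + suc c - + h)
formula-isolated s p c h e rewrite e = ZS.solve 3 (λ p c h → ZS.con (+ 2) ZS.:* (p ZS.:+ c ZS.:- h) ZS.:+ ZS.con (+ 4) ZS.:= ZS.con (+ 2) ZS.:* (ZS.con 1ℤ ZS.:+ p ZS.:+ (ZS.con 1ℤ ZS.:+ c) ZS.:- h)) refl (+ p) (+ c) (+ h)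

formula-hole : ∀ s p c h → s ≡ + 2 * (+ p + + c - + h) → s + + 0 ≡ + 2 * (+ suc p + + c - + suc h)
formula-hole s p c h e rewrite e = ZS.solve 3 (λ p c h → ZS.con (+ 2) ZS.:* (p ZS.:+ c ZS.:- h) ZS.:+ ZS.con (+ 0) ZS.:= ZS.con (+ 2) ZS.:* (ZS.con 1ℤ ZS.:+ p ZS.:+ c ZS.:- (ZS.con 1ℤ ZS.:+ h))) refl (+ p) (+ c) (+ h)

formula-merge : ∀ s p c h → s ≡ + 2 * (+ p + + suc c - + h) → s + + 0 ≡ + 2 * (+ suc p + + c - + h)
formula-merge s p c h e rewrite e = ZS.solve 3 (λ p c h → ZS.con (+ 2) ZS.:* (p ZS.:+ (ZS.con 1ℤ ZS.:+ c) ZS.:- h) ZS.:+ ZS.con (+ 0) ZS.:= ZS.con (+ 2) ZS.:* (ZS.con 1ℤ ZS.:+ p ZS.:+ c ZS.:- h)) refl (+ p) (+ c) (+ h)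

Δψ-B∈ : ∀ l ll br → Δψ l ll true br ≡ + 2
Δψ-B∈ true true true = refl
Δψ-B∈ true true false = refl
Δψ-B∈ true false true = refl
Δψ-B∈ true false false = refl
Δψ-B∈ false true true = refl
Δψ-B∈ false true false = refl
Δψ-B∈ false false true = refl
Δψ-B∈ false false false = refl

Δψ-L∈ : ∀ ll → Δψ true ll false false ≡ + 2
Δψ-L∈ true = refl
Δψ-L∈ false = refl

Δψ-critical : ∀ l ll → l ∨ ll ≡ true → Δψ l ll false true ≡ + 0
Δψ-critical true true _ = refl
Δψ-critical true false _ = refl
Δψ-critical false true _ = refl

module Step {M : ℕ} {D D' : Obj} {a b : ℤ} (σ : LastPixelSplit M D D' a b)
  (lenD : length D ≡ suc (length D')) (formula' : PotentialFormula M D') where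

  open LastPixelSplit σ
  open Σ formula' renaming (proj₁ to c'; proj₂ to rest)
  open Σ rest renaming (proj₁ to h'; proj₂ to rest')

  nc' : Components D' c'
  nc' = proj₁ rest'

  hn' : Holes D' h'
  hn' = proj₁ (proj₂ rest')

  eq' : potential M D' ≡ + 2 * (+ length D' + + c' - + h')
  eq' = proj₂ (proj₂ rest')
  open LastPixel σ
  open PotentialStep σ

  ∉D'⇒∉D : ∀ y → ¬ y ≡ X → y ∉ D' → y ∉ D
  ∉D'⇒∉D y ne n m with mem→ y m
  ... | inj₁ e = ne e
  ... | inj₂ m' = n m'

  L≢ : ¬ L ≡ X
  L≢ e = i-1≢i a (cong proj₁ e)
  LL≢ : ¬ LL ≡ X
  LL≢ e = i-1≢i a (cong proj₁ e)
  B≢ : ¬ B ≡ X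
  B≢ e = i-1≢i b (cong proj₂ e)
  BR≢ : ¬ BR ≡ X
  BR≢ e = i+1≢i a (cong proj₁ e)

  formula-after-step : ∀ {c h} δ → potential M D ≡ potential M D' + δ → potential M D' + δ ≡ + 2 * (+ suc (length D') + + c - + h) →
    potential M D ≡ + 2 * (+ length D + + c - + h)
  formula-after-step δ e1 e2 rewrite lenD = trans e1 e2

  neighbours-outside : (B ∉ D → Ext.Outside B) → ∀ nb → nb ∉ D → Adj1 nb X → Ext.Outside nb
  neighbours-outside bi nb n adj with Adj1-x⇒ nb adj
  ... | inj₁ refl = L-outside n
  ... | inj₂ (inj₁ refl) = R-outside
  ... | inj₂ (inj₂ (inj₁ refl)) = U-outside
  ... | inj₂ (inj₂ (inj₂ refl)) = bi n

  step-B : B ∈ D' → potential M D ≡ potential M D' + + 2 → ¬ ¬ (PotentialFormula M D)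
  step-B Bm eS = pure (c' , h' , components-attach B Bm (Adj0-nbr a b Z0 M1 Z0 Z0) all0 nc' ,
                    holes-unchanged (neighbours-outside (λ n → ⊥-elim (n (∈D'⇒∈D B Bm)))) hn' ,
                    formula-after-step {c'} {h'} (+ 2) eS (formula-attach _ (length D') c' h' eq'))
    where
    all0 : ∀ y → y ∈ D' → Adj0 y X → Comp0 D' y B
    all0 y m adj with Adj0-x⇒ y m adj
    ... | inj₁ refl = Conn-step m Bm (Adj0-nbr a b M1 Z0 Z0 M1)
    ... | inj₂ (inj₁ refl) = Conn-step m Bm (Adj0-nbr a b M1 M1 Z0 M1)
    ... | inj₂ (inj₂ (inj₁ refl)) = ε
    ... | inj₂ (inj₂ (inj₂ refl)) = Conn-step m Bm (Adj0-nbr a b P1 M1 Z0 M1)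

  B-outside-via-BR : B ∉ D' → BR ∉ D' → B ∉ D → Ext.Outside B
  B-outside-via-BR nB nBR nBD = Conn-step nBD (∉D'⇒∉D BR BR≢ nBR) (Adj1-nbr a b Z0 M1 P1 M1) ◅◅ Conn-step (∉D'⇒∉D BR BR≢ nBR) R∉D (Adj1-nbr a b P1 M1 P1 Z0) ◅◅ R-outside

  step-L : ∀ {ll} → L ∈ D' → memberᵇ D' LL ≡ ll → B ∉ D' → BR ∉ D' → potential M D ≡ potential M D' + + 2 → ¬ ¬ (PotentialFormula M D)
  step-L Lm _ nB nBR eS = pure (c' , h' , components-attach L Lm (Adj0-nbr a b M1 Z0 Z0 Z0) all0 nc' ,
                    holes-unchanged (neighbours-outside (B-outside-via-BR nB nBR)) hn' ,
                    formula-after-step {c'} {h'} (+ 2) eS (formula-attach _ (length D') c' h' eq'))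
    where
    all0 : ∀ y → y ∈ D' → Adj0 y X → Comp0 D' y L
    all0 y m adj with Adj0-x⇒ y m adj
    ... | inj₁ refl = ε
    ... | inj₂ (inj₁ refl) = Conn-step m Lm (Adj0-nbr a b M1 M1 M1 Z0)
    ... | inj₂ (inj₂ (inj₁ refl)) = ⊥-elim (nB m)
    ... | inj₂ (inj₂ (inj₂ refl)) = ⊥-elim (nBR m)

  step-LL : L ∉ D' → LL ∈ D' → B ∉ D' → BR ∉ D' → potential M D ≡ potential M D' + + 2 → ¬ ¬ (PotentialFormula M D)
  step-LL nL LLm nB nBR eS = pure (c' , h' , components-attach LL LLm (Adj0-nbr a b M1 M1 Z0 Z0) all0 nc' ,
                    holes-unchanged (neighbours-outside (B-outside-via-BR nB nBR)) hn' ,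
                    formula-after-step {c'} {h'} (+ 2) eS (formula-attach _ (length D') c' h' eq'))
    where
    all0 : ∀ y → y ∈ D' → Adj0 y X → Comp0 D' y LL
    all0 y m adj with Adj0-x⇒ y m adj
    ... | inj₁ refl = ⊥-elim (nL m)
    ... | inj₂ (inj₁ refl) = ε
    ... | inj₂ (inj₂ (inj₁ refl)) = ⊥-elim (nB m)
    ... | inj₂ (inj₂ (inj₂ refl)) = ⊥-elim (nBR m)

  step-isolated : L ∉ D' → LL ∉ D' → B ∉ D' → BR ∉ D' → potential M D ≡ potential M D' + + 4 → ¬ ¬ (PotentialFormula M D)
  step-isolated nL nLL nB nBR eS = pure (suc c' , h' , components-isolated nonb nc' ,
                    holes-unchanged (neighbours-outside (B-outside-via-BR nB nBR)) hn' ,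
                    formula-after-step {suc c'} {h'} (+ 4) eS (formula-isolated _ (length D') c' h' eq'))
    where
    nonb : ∀ y → y ∈ D' → ¬ Adj0 y X
    nonb y m adj with Adj0-x⇒ y m adj
    ... | inj₁ refl = nL m
    ... | inj₂ (inj₁ refl) = nLL m
    ... | inj₂ (inj₂ (inj₁ refl)) = nB m
    ... | inj₂ (inj₂ (inj₂ refl)) = nBR m

  step-BR : L ∉ D' → LL ∉ D' → B ∉ D' → BR ∈ D' → potential M D ≡ potential M D' + + 2 → ¬ ¬ (PotentialFormula M D)
  step-BR nL nLL nB BRm eS = pure (c' , h' , components-attach BR BRm (Adj0-nbr a b P1 M1 Z0 Z0) all0 nc' ,
                    holes-unchanged (neighbours-outside binf) hn' ,
                    formula-after-step {c'} {h'} (+ 2) eS (formula-attach _ (length D') c' h' eq'))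
    where
    all0 : ∀ y → y ∈ D' → Adj0 y X → Comp0 D' y BR
    all0 y m adj with Adj0-x⇒ y m adj
    ... | inj₁ refl = ⊥-elim (nL m)
    ... | inj₂ (inj₁ refl) = ⊥-elim (nLL m)
    ... | inj₂ (inj₂ (inj₁ refl)) = ⊥-elim (nB m)
    ... | inj₂ (inj₂ (inj₂ refl)) = ε
    binf : B ∉ D → Ext.Outside B
    binf nBD = Conn-step nBD (∉D'⇒∉D LL LL≢ nLL) (Adj1-nbr a b Z0 M1 M1 M1) ◅◅ Conn-step (∉D'⇒∉D LL LL≢ nLL) (∉D'⇒∉D L L≢ nL) (Adj1-nbr a b M1 M1 M1 Z0) ◅◅ L-outside (∉D'⇒∉D L L≢ nL)

  module Critical (N : Pixel) (Nm : N ∈ D') (vN : HasVertex N (a - 1ℤ , b - 1ℤ)) (aN : Adj0 N X) (nB : B ∉ D') (BRm : BR ∈ D')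
    (allN : ∀ y → y ∈ D' → (y ≡ L ⊎ y ≡ LL) → Comp0 D' y N) (eS : potential M D ≡ potential M D' + + 0) where

    nBD : B ∉ D
    nBD = ∉D'⇒∉D B B≢ nB

    vBR : HasVertex BR (a , b - 1ℤ)
    vBR = inj₂ refl , inj₁ refl

    encloses-B : Comp0 D' N BR → ¬ ¬ (PotentialFormula M D)
    encloses-B c = ¬¬-decidableOn Ext'.Outside (box M) >>= λ decI →
      pure (c' , suc h' , components-attach N Nm aN all0 nc' , holes-new nBD niB nbrs-outside-or-B decI hn' ,
            formula-after-step {c'} {suc h'} (+ 0) eS (formula-hole _ (length D') c' h' eq'))
      where
      all0 : ∀ y → y ∈ D' → Adj0 y X → Comp0 D' y N
      all0 y m adj with Adj0-x⇒ y m adj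
      ... | inj₁ refl = allN y m (inj₁ refl)
      ... | inj₂ (inj₁ refl) = allN y m (inj₂ refl)
      ... | inj₂ (inj₂ (inj₁ refl)) = ⊥-elim (nB m)
      ... | inj₂ (inj₂ (inj₂ refl)) = Conn0-sym c
      niB : ¬ Ext.Outside B
      niB inf = loop-separates (λ y → y ∈ D') (λ y → y ∈ D) a b N BR ∈D'⇒∈D x∈D x∉D' nBD (rowAbove∉D' a) Nm vN vBR c (inf ◅◅ Conn1-sym U-outside)
      nbrs-outside-or-B : ∀ nb → nb ∉ D → Adj1 nb X → Ext.Outside nb ⊎ Ext.Conn1ᶜ nb B
      nbrs-outside-or-B nb n adj with Adj1-x⇒ nb adj
      ... | inj₁ refl = inj₁ (L-outside n)
      ... | inj₂ (inj₁ refl) = inj₁ R-outside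
      ... | inj₂ (inj₂ (inj₁ refl)) = inj₁ U-outside
      ... | inj₂ (inj₂ (inj₂ refl)) = inj₂ ε

    merges-N-BR : ¬ Comp0 D' N BR → ¬ ¬ (PotentialFormula M D)
    merges-N-BR nc with components-merge N BR Nm BRm aN (Adj0-nbr a b P1 M1 Z0 Z0) nc all12 nc'
      where
      all12 : ∀ y → y ∈ D' → Adj0 y X → Comp0 D' y N ⊎ Comp0 D' y BR
      all12 y m adj with Adj0-x⇒ y m adj
      ... | inj₁ refl = inj₁ (allN y m (inj₁ refl))
      ... | inj₂ (inj₁ refl) = inj₁ (allN y m (inj₂ refl))
      ... | inj₂ (inj₂ (inj₁ refl)) = ⊥-elim (nB m)
      ... | inj₂ (inj₂ (inj₂ refl)) = inj₂ ε
    ... | c , nc2 , refl = ¬¬-excluded-middle {A = Ext.Outside B} >>= λ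
      { (yes inf) → pure (c , h' , nc2 , holes-unchanged (neighbours-outside (λ _ → inf)) hn' ,
                          formula-after-step {c} {h'} (+ 0) eS (formula-merge _ (length D') c h' eq'))
      ; (no ni) → enclosed⇒Conn0 σ N Nm vN BRm nBD ni >>= λ cc → ⊥-elim (nc cc) }

    step : ¬ ¬ (PotentialFormula M D)
    step = ¬¬-excluded-middle {A = Comp0 D' N BR} >>= λ { (yes c) → encloses-B c ; (no nc) → merges-N-BR nc }

  step-cases : ∀ l ll bb br → memberᵇ D' L ≡ l → memberᵇ D' LL ≡ ll → memberᵇ D' B ≡ bb → memberᵇ D' BR ≡ br →
    potential M D ≡ potential M D' + Δψ l ll bb br → ¬ ¬ (PotentialFormula M D)
  step-cases l ll true br el ell eb ebr eS = step-B (memberᵇ⇒∈ eb) (trans eS (cong (λ w → potential M D' + w) (Δψ-B∈ l ll br)))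
  step-cases true ll false false el ell eb ebr eS = step-L (memberᵇ⇒∈ el) ell (memberᵇ-false⇒∉ eb) (memberᵇ-false⇒∉ ebr) (trans eS (cong (λ w → potential M D' + w) (Δψ-L∈ ll)))
  step-cases false true false false el ell eb ebr eS = step-LL (memberᵇ-false⇒∉ el) (memberᵇ⇒∈ ell) (memberᵇ-false⇒∉ eb) (memberᵇ-false⇒∉ ebr) eS
  step-cases false false false false el ell eb ebr eS = step-isolated (memberᵇ-false⇒∉ el) (memberᵇ-false⇒∉ ell) (memberᵇ-false⇒∉ eb) (memberᵇ-false⇒∉ ebr) eS
  step-cases false false false true el ell eb ebr eS = step-BR (memberᵇ-false⇒∉ el) (memberᵇ-false⇒∉ ell) (memberᵇ-false⇒∉ eb) (memberᵇ⇒∈ ebr) eS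
  step-cases true ll false true el ell eb ebr eS =
    Critical.step L (memberᵇ⇒∈ el) (inj₁ refl , inj₂ (sym (i-1+1≡i b))) (Adj0-nbr a b M1 Z0 Z0 Z0) (memberᵇ-false⇒∉ eb) (memberᵇ⇒∈ ebr) allN
      (trans eS (cong (λ w → potential M D' + w) (Δψ-critical true ll refl)))
    where
    allN : ∀ y → y ∈ D' → (y ≡ L ⊎ y ≡ LL) → Comp0 D' y L
    allN y m (inj₁ refl) = ε
    allN y m (inj₂ refl) = Conn-step m (memberᵇ⇒∈ el) (Adj0-nbr a b M1 M1 M1 Z0)
  step-cases false true false true el ell eb ebr eS =
    Critical.step LL (memberᵇ⇒∈ ell) (inj₁ refl , inj₁ refl) (Adj0-nbr a b M1 M1 Z0 Z0) (memberᵇ-false⇒∉ eb) (memberᵇ⇒∈ ebr) allN eS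
    where
    allN : ∀ y → y ∈ D' → (y ≡ L ⊎ y ≡ LL) → Comp0 D' y LL
    allN y m (inj₁ refl) = ⊥-elim (memberᵇ-false⇒∉ el m)
    allN y m (inj₂ refl) = ε

  step : ¬ ¬ (PotentialFormula M D)
  step = step-cases _ _ _ _ refl refl refl refl potential-step

LexLe : Pixel → Pixel → Set
LexLe (p , q) (a , b) = (q < b) ⊎ (q ≡ b × p ≤ a)

lex? : ∀ u v → Dec (LexLe u v)
lex? (p , q) (a , b) with q ZP.<? b | q ZP.≟ b | p ZP.≤? a
... | yes l | _ | _ = yes (inj₁ l)
... | no _ | yes e | yes l = yes (inj₂ (e , l))
... | no nl | no ne | _ = no λ { (inj₁ l) → nl l ; (inj₂ (e , _)) → ne e }
... | no nl | yes _ | no nle = no λ { (inj₁ l) → nl l ; (inj₂ (_ , l)) → nle l }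

lex-refl : ∀ u → LexLe u u
lex-refl (p , q) = inj₂ (refl , ZP.≤-refl)

lex-flip : ∀ u v → ¬ LexLe u v → LexLe v u
lex-flip (p , q) (a , b) n with q ZP.≟ b
... | yes refl = inj₂ (refl , ZP.<⇒≤ (ZP.≰⇒> (λ l → n (inj₂ (refl , l)))))
... | no ne = inj₁ (ZP.≤∧≢⇒< (ZP.≮⇒≥ (λ l → n (inj₁ l))) (λ e → ne (sym e)))

lex-trans : ∀ u v w → LexLe u v → LexLe v w → LexLe u w
lex-trans u v w (inj₁ l1) (inj₁ l2) = inj₁ (ZP.<-trans l1 l2)
lex-trans u v w (inj₁ l1) (inj₂ (refl , _)) = inj₁ l1
lex-trans u v w (inj₂ (refl , _)) (inj₁ l2) = inj₁ l2
lex-trans u v w (inj₂ (refl , l1)) (inj₂ (refl , l2)) = inj₂ (refl , ZP.≤-trans l1 l2)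

lexMax : ∀ (D : Obj) x0 → Σ Pixel λ x → x ∈ x0 ∷ D × (∀ y → y ∈ x0 ∷ D → LexLe y x)
lexMax [] x0 = x0 , here refl , λ { y (here refl) → lex-refl y }
lexMax (z ∷ D) x0 with lexMax D z
... | m , mm , mx with lex? x0 m
...   | yes l = m , there mm , λ { y (here refl) → l ; y (there ym) → mx y ym }
...   | no nl = x0 , here refl , λ { y (here refl) → lex-refl y ; y (there ym) → lex-trans y m x0 (mx y ym) (lex-flip x0 m nl) }

Any-insert : ∀ {P : Pixel → Set} pre z post → Any P (pre ++ post) → Any P (pre ++ z ∷ post)
Any-insert [] z post a = there a
Any-insert (x ∷ pre) z post (here p) = here p
Any-insert (x ∷ pre) z post (there a) = there (Any-insert pre z post a)

potentialFormula-[] : ∀ M → PotentialFormula M []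
potentialFormula-[] M = 0 , 0 , ([] , refl , [] , [] , λ y ()) , ([] , refl , [] , [] , λ y h → ⊥-elim (no-hole y h)) , sum-zero
  where
  no-hole : ∀ y → ¬ InHole [] y
  no-hole (p , q) (_ , fin) = Exterior.Outside⇒¬Finite M [] (λ y ()) _ (Exterior.emptyRow⇒Outside M [] (λ y ()) q (λ p ()) p) fin
  sum-zero : potential M [] ≡ + 2 * (+ 0 + + 0 - + 0)
  sum-zero = sumL-zero (Ψ []) (gridBox M) (λ g → refl)

lastPixelSplit : ∀ {M} pre post {a b} → Unique (pre ++ (a , b) ∷ post) → Bounded M (pre ++ (a , b) ∷ post) →
  (∀ y → y ∈ pre ++ (a , b) ∷ post → LexLe y (a , b)) → LastPixelSplit M (pre ++ (a , b) ∷ post) (pre ++ post) a b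
lastPixelSplit {M} pre post {a} {b} u bnd x-max =
  record { bounded = bnd ; mem→ = mem→ ; mem← = mem← ; x∉D' = x∉D' ; x-last = x-last }
  where
  mem→ : ∀ y → y ∈ pre ++ (a , b) ∷ post → y ≡ (a , b) ⊎ y ∈ pre ++ post
  mem→ y m with Any-middle pre (a , b) post m
  ... | inj₁ m' = inj₂ m'
  ... | inj₂ e = inj₁ e
  mem← : ∀ y → y ≡ (a , b) ⊎ y ∈ pre ++ post → y ∈ pre ++ (a , b) ∷ post
  mem← y (inj₁ refl) = ∈-++⁺ʳ pre (here refl)
  mem← y (inj₂ m) = Any-insert pre (a , b) post m
  x∉D' : (a , b) ∉ pre ++ post
  x∉D' m with AllPairs-middle pre (a , b) post u (a , b) m
  ... | inj₁ ne = ne refl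
  ... | inj₂ ne = ne refl
  x-last : ∀ p q → (p , q) ∈ pre ++ post → (q < b) ⊎ (q ≡ b × p < a)
  x-last p q m with x-max (p , q) (mem← _ (inj₂ m))
  ... | inj₁ l = inj₁ l
  ... | inj₂ (refl , le) = inj₂ (refl , ZP.≤∧≢⇒< le (λ { refl → x∉D' m }))

potentialFormula : ∀ M n (D : Obj) → length D ≡ n → Unique D → Bounded M D → ¬ ¬ (PotentialFormula M D)

potentialFormula-removeLast : ∀ M n (D : Obj) {x} → length D ≡ suc n → Unique D → Bounded M D →
  (∀ y → y ∈ D → LexLe y x) → (Σ (List Pixel) λ pre → Σ Pixel λ z → Σ (List Pixel) λ post → D ≡ pre ++ z ∷ post × x ≡ z) →
  ¬ ¬ (PotentialFormula M D)

potentialFormula M zero [] _ _ _ = pure (potentialFormula-[] M)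
potentialFormula M (suc n) (y ∷ E) len u bnd with lexMax E y
... | x , x∈ , x-max = potentialFormula-removeLast M n (y ∷ E) len u bnd x-max (Any-split x∈)

potentialFormula-removeLast M n .(pre ++ x ∷ post) {x} len u bnd x-max (pre , .x , post , refl , refl) =
  potentialFormula M n (pre ++ post) (NP.suc-injective (trans (sym lenD) len)) (AllPairs-remove pre x post u) (LastPixel.bounded' σ)
    >>= Step.step σ lenD
  where
  σ : LastPixelSplit M (pre ++ x ∷ post) (pre ++ post) (proj₁ x) (proj₂ x)
  σ = lastPixelSplit pre post u bnd x-max
  lenD : length (pre ++ x ∷ post) ≡ suc (length (pre ++ post))
  lenD = LP.length-++-sucʳ pre x post

potential≡v+b-t : ∀ {M D v b t} → Bounded M D → HasSize (IsVertex D) v → HasSize (Block D) b → HasSize (Tunnel D) t →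
  potential M D ≡ (+ v + + b) - + t
potential≡v+b-t {M} {D} {v} {b} {t} bnd hv hb ht =
  trans (sumL-cong (Ψ D) (λ g → (count isVertexᵇ g + count isBlockᵇ g) - count isTunnelᵇ g) (gridBox M) (λ { (i , j) → refl }))
  (trans (sumL-difference (λ g → count isVertexᵇ g + count isBlockᵇ g) (count isTunnelᵇ) (gridBox M))
  (trans (cong (_- sumL (count isTunnelᵇ) (gridBox M)) (sumL-+ (count isVertexᵇ) (count isBlockᵇ) (gridBox M)))
  (sym (cong₂ _-_ (cong₂ _+_ v-sum b-sum) t-sum))))
  where
  open Support M D bnd
  count : (Obj → GridPoint → Bool) → GridPoint → ℤ
  count T g = toℤ (T D g)
  v-sum : + v ≡ sumL (count isVertexᵇ) (gridBox M)
  v-sum = HasSize⇒sumL (isVertexᵇ D) (gridBox M) (gridBox-unique M) (IsVertex⇒isVertexᵇ D) (isVertexᵇ⇒IsVertex D) isVertexᵇ⇒∈gridBox hv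
  b-sum : + b ≡ sumL (count isBlockᵇ) (gridBox M)
  b-sum = HasSize⇒sumL (isBlockᵇ D) (gridBox M) (gridBox-unique M) (Block⇒isBlockᵇ D) (isBlockᵇ⇒Block D) isBlockᵇ⇒∈gridBox hb
  t-sum : + t ≡ sumL (count isTunnelᵇ) (gridBox M)
  t-sum = HasSize⇒sumL (isTunnelᵇ D) (gridBox M) (gridBox-unique M) (Tunnel⇒isTunnelᵇ D) (isTunnelᵇ⇒Tunnel D) isTunnelᵇ⇒∈gridBox ht

solve-for-t : ∀ {s x : ℤ} v b t → s ≡ (v + b) - t → s ≡ + 2 * x → t ≡ v - + 2 * x + b
solve-for-t v b t s≡v+b-t s≡2x =
  trans (ZS.solve 3 (λ v b t → t ZS.:= v ZS.:- ((v ZS.:+ b) ZS.:- t) ZS.:+ b) refl v b t)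
        (cong (λ w → v - w + b) (trans (sym s≡v+b-t) s≡2x))

-- The formula also holds for the empty object.
theorem1 : (D : Obj) → D ≢ [] → Unique D →
    (v h c b t : ℕ) →
    HasSize (IsVertex D) v →
    NumClasses (InHole D) (CompCompl1 D) h →
    NumClasses (λ x → x ∈ D) (Comp0 D) c →
    HasSize (Block D) b →
    HasSize (Tunnel D) t →
    + t ≡ + v - + 2 * (+ length D + + c - + h) + + b
theorem1 D _ uD v h c b t hv hh hc hb ht =
  decidable-stable (+ t ZP.≟ + v - + 2 * (+ length D + + c - + h) + + b) do
    (c′ , h′ , components , holes , formula) ← potentialFormula M (length D) D refl uD bnd
    pure (solve-for-t (+ v) (+ b) (+ t) (potential≡v+b-t bnd hv hb ht)
      (subst₂ (λ c h → potential M D ≡ + 2 * (+ length D + + c - + h))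
        (Components-unique components hc) (Holes-unique holes hh) formula))
  where
  M : ℕ
  M = proj₁ (boundingBox D)
  bnd : Bounded M D
  bnd = proj₂ (boundingBox D)
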